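{- Let $\mathcal{A}$ be a primitive integral Apollonian circle packing of type $(6,k)$, $k\in\{1,5,13,17\}$. Then the following sets form reciprocity obstructions for $\mathcal{A}$: - type $(6,1)$, $\chi_2(\mathcal{A})=1$: none listed; $\chi_2(\mathcal{A})=-1$: $S_{2,1},S_{2,2},S_{2,3},S_{2,6}$; - type $(6,5)$, $\chi_2(\mathcal{A})=1$: $S_{2,2},S_{2,3}$; $\chi_2(\mathcal{A})=-1$: $S_{2,1},S_{2,6}$; - type $(6,13)$, $\chi_2(\mathcal{A})=1$: $S_{2,2},S_{2,6}$; $\chi_2(\mathcal{A})=-1$: $S_{2,1},S_{2,3}$; - type $(6,17)$, $\chi_2(\mathcal{A})=1$: $S_{2,3},S_{2,6}$; $\chi_2(\mathcal{A})=-1$: $S_{2,1},S_{2,2}$.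
   Context: Apollonian packings: start from four mutually tangent circles in the plane (lines allowed) and repeatedly add, for every triple of mutually tangent circles present, the two circles tangent to all three. Curvatures are signed ($1/\text{radius}$; lines $0$; a circle containing the others in its interior is negative). Primitive integral: all curvatures integers with overall gcd $1$. $R(\mathcal{A})$ is the set of residues mod $24$ of curvatures of $\mathcal{A}$. Type $(6,1)$: $R(\mathcal{A})=\{0,1,4,9,12,16\}$; $(6,5)$: $\{0,5,8,12,20,21\}$; $(6,13)$: $\{0,4,12,13,16,21\}$; $(6,17)$: $\{0,8,9,12,17,20\}$. For $u,d>0$, $S_{d,u}=\{un^d:n\in\mathbb{Z}\}$; it forms a reciprocity obstruction for $\mathcal{A}$ if infinitely many of its elements have residue mod $24$ in $R(\mathcal{A})$ but none of its elements is the curvature of a circle of $\mathcal{A}$. $\chi_2(\mathcal{A})$: for a circle $\mathcal{C}$ of nonzero curvature $n$, choose circles of $\mathcal{A}$ of curvatures $b,c,d$ mutually tangent with $\mathcal{C}$ and set $f_{\mathcal{C}}(x,y)=(n+b)x^2+(n+b+c-d)xy+(n+c)y^2$; the residues mod $n$ of values $f_{\mathcal{C}}(x,y)$, $\gcd(x,y)=1$, coprime to $n$ lie in one coset of the squares in $(\mathbb{Z}/n\mathbb{Z})^\times$; take a positive integer $\rho$ in it; $\chi_2(\mathcal{C})$ is the Kronecker symbol $\left(\frac{\rho}{n}\right)$, $\left(\frac{ -\rho}{n/2}\right)$, or $\left(\frac{2\rho}{n}\right)$ according as $n\equiv 0,1$, $2$, or $3\pmod 4$. It is well defined and the same for all circles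 of nonzero curvature of $\mathcal{A}$; this common value is $\chi_2(\mathcal{A})\in\{\pm1\}$. -}

module Defs where

open import Data.Bool using (Bool; true; false; if_then_else_; _∨_)
open import Data.Nat as ℕ using (ℕ; zero; suc; _≡ᵇ_)
import Data.Nat.DivMod as ℕD
open import Data.Nat.Coprimality using (Coprime)
open import Data.Integer as ℤ using (ℤ; +_; -[1+_]; ∣_∣; _+_; _-_; _*_; -_; _^_; _<_; 1ℤ; -1ℤ; 0ℤ)
open import Data.Integer.DivMod using (_%ℕ_; _/_)
open import Data.Integer.Divisibility using (_∣_)
open import Data.List using (List; _∷_; []; upTo)
open import Data.Bool.ListAction using (any)
open import Data.List.Membership.Propositional using (_∈_)
open import Data.Product using (Σ; ∃; ∃-syntax; _×_; _,_)
open import Function.Bundles using (_⇔_)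
open import Relation.Binary.PropositionalEquality using (_≡_; _≢_)
open import Relation.Nullary using (¬_)

-- An integral Apollonian packing is determined (up to motions, which do
-- not affect anything in this statement) by one Descartes quadruple of
-- curvatures (a,b,c,d) of four mutually tangent circles in it.  Such an
-- integer quadruple satisfies the Descartes relation
--   (a+b+c+d)^2 = 2(a^2+b^2+c^2+d^2)
-- and (with the paper's orientation convention) a+b+c+d > 0; conversely
-- every such integer quadruple is the curvature quadruple of a Descartes
-- configuration generating an integral packing.

record Quad : Set where
  constructor quad
  field
    q₁ q₂ q₃ q₄ : ℤ

record Packing : Set where
  constructor packing
  field
    root      : Quad
    descartes : let open Quad root in
                (q₁ + q₂ + q₃ + q₄) ^ 2
                  ≡ + 2 * (q₁ ^ 2 + q₂ ^ 2 + q₃ ^ 2 + q₄ ^ 2)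
    positive  : let open Quad root in 0ℤ < q₁ + q₂ + q₃ + q₄

-- The (ordered) Descartes quadruples of mutually tangent circles of the
-- packing: generated from the root by the four Apollonian moves (replace
-- one circle by the other circle tangent to the remaining three) and by
-- reorderings (adjacent transpositions generate all of S₄).
data Reachable (A : Packing) : Quad → Set where
  root : Reachable A (Packing.root A)
  s₁   : ∀ {a b c d} → Reachable A (quad a b c d) →
         Reachable A (quad (+ 2 * (b + c + d) - a) b c d)
  s₂   : ∀ {a b c d} → Reachable A (quad a b c d) →
         Reachable A (quad a (+ 2 * (a + c + d) - b) c d)
  s₃   : ∀ {a b c d} → Reachable A (quad a b c d) →
         Reachable A (quad a b (+ 2 * (a + b + d) - c) d)
  s₄   : ∀ {a b c d} → Reachable A (quad a b c d) →
         Reachable A (quad a b c (+ 2 * (a + b + c) - d))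
  swap₁₂ : ∀ {a b c d} → Reachable A (quad a b c d) → Reachable A (quad b a c d)
  swap₂₃ : ∀ {a b c d} → Reachable A (quad a b c d) → Reachable A (quad a c b d)
  swap₃₄ : ∀ {a b c d} → Reachable A (quad a b c d) → Reachable A (quad a b d c)

Curv : Packing → ℤ → Set
Curv A n = ∃[ b ] ∃[ c ] ∃[ d ] Reachable A (quad n b c d)

Primitive : Packing → Set
Primitive A = ∀ (g : ℕ) → (∀ c → Curv A c → + g ∣ c) → g ≡ 1

InR : Packing → ℕ → Set
InR A r = ∃[ c ] Curv A c × c %ℕ 24 ≡ r

R61 R65 R613 R617 : List ℕ
R61  = 0 ∷ 1 ∷ 4 ∷ 9 ∷ 12 ∷ 16 ∷ []
R65  = 0 ∷ 5 ∷ 8 ∷ 12 ∷ 20 ∷ 21 ∷ []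
R613 = 0 ∷ 4 ∷ 12 ∷ 13 ∷ 16 ∷ 21 ∷ []
R617 = 0 ∷ 8 ∷ 9 ∷ 12 ∷ 17 ∷ 20 ∷ []

HasResidues : Packing → List ℕ → Set
HasResidues A L = ∀ (r : ℕ) → InR A r ⇔ r ∈ L

symAtPrime : ℤ → ℕ → ℤ
symAtPrime a 0 = 0ℤ
symAtPrime a 1 = 0ℤ
symAtPrime a 2 with a %ℕ 8
... | 1 = 1ℤ
... | 7 = 1ℤ
... | 3 = -1ℤ
... | 5 = -1ℤ
... | _ = 0ℤ
symAtPrime a p@(suc (suc (suc k))) =
  if a %ℕ p ≡ᵇ 0 then 0ℤ
  else if any (λ x → ((x ℕ.* x) ℕD.% p) ≡ᵇ (a %ℕ p)) (upTo p) then 1ℤ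
  else -1ℤ

firstDivFrom : ℕ → ℕ → ℕ → ℕ
firstDivFrom zero    k m = m
firstDivFrom (suc f) k m =
  if (m ℕD.% suc (suc k)) ≡ᵇ 0 then suc (suc k) else firstDivFrom f (suc k) m

minPrimeFactor : ℕ → ℕ
minPrimeFactor m = firstDivFrom m 0 m

kronPos : ℕ → ℤ → ℕ → ℤ
kronPos zero    a m = 1ℤ
kronPos (suc f) a 0 = 1ℤ
kronPos (suc f) a 1 = 1ℤ
kronPos (suc f) a m@(suc (suc k)) with minPrimeFactor m
... | 0 = 1ℤ
... | p@(suc p') = symAtPrime a p * kronPos f a (m ℕD./ p)

kronecker : ℤ → ℤ → ℤ
kronecker a (+ 0) = if (∣ a ∣ ≡ᵇ 1) then 1ℤ else 0ℤ
kronecker a (+ suc m) = kronPos (suc m) a (suc m)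
kronecker a -[1+ m ] = signPart a * kronPos (suc m) a (suc m)
  where
  signPart : ℤ → ℤ
  signPart -[1+ _ ] = -1ℤ
  signPart (+ _)    = 1ℤ

abs : ℤ → ℕ
abs = ∣_∣

-- f_C(x,y) for the circle C of curvature n with tangent circles b, c, d
fC : ℤ → ℤ → ℤ → ℤ → ℤ → ℤ → ℤ
fC n b c d x y = (n + b) * x * x + (n + b + c - d) * x * y + (n + c) * y * y

-- ρ is a positive integer in the coset of squares of (ℤ/nℤ)^× containing
-- the residues mod n of the values f_C(x,y), gcd(x,y)=1, coprime to n
IsRho : ℤ → ℤ → ℤ → ℤ → ℕ → Set
IsRho n b c d ρ =
  0 ℕ.< ρ × Coprime ρ (abs n) ×
  ∃[ x ] ∃[ y ] ∃[ t ]
    (Coprime (abs x) (abs y) × Coprime (abs (fC n b c d x y)) (abs n) ×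
     Coprime (abs t) (abs n) × (n ∣ (+ ρ - fC n b c d x y * t * t)))

chiSymbol : ℤ → ℕ → ℤ
chiSymbol n ρ with n %ℕ 4
... | 2 = kronecker (- + ρ) (n / + 2)
... | 3 = kronecker (+ 2 * + ρ) n
... | _ = kronecker (+ ρ) n

Chi2 : Packing → ℤ → Set
Chi2 A ε = ∀ n b c d → Reachable A (quad n b c d) → n ≢ 0ℤ →
           ∀ ρ → IsRho n b c d ρ → chiSymbol n ρ ≡ ε

InS : ℕ → ℕ → ℤ → Set
InS d u m = ∃[ n ] m ≡ + u * n ^ d

-- S_{d,u} is a reciprocity obstruction for A: infinitely many (i.e.
-- arbitrarily large in absolute value) elements have residue mod 24 in
-- R(A), and no element is a curvature of A
Obstruction : Packing → ℕ → ℕ → Set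
Obstruction A d u =
  (∀ (N : ℕ) → ∃[ m ] InS d u m × N ℕ.< abs m × InR A (m %ℕ 24)) ×
  (∀ m → InS d u m → ¬ Curv A m)

-- If u·M² (M ≥ 1) were the curvature N of a circle C, the form f_C would yield an admissible ρ.
-- Euclid's algorithm on a coprime pair (x, y) is a chain of Apollonian moves, so f_C(x, y) = N + b′
-- with b′ the curvature of a circle tangent to C; and taking x, y to be products of suitable primes
-- of N makes f_C(x, y) coprime to N.  Then ρ = (f_C(x, y) mod N) + N ≡ b′ (mod N).
-- Since N ≡ 0, 1 (mod 4), χ₂ = (ρ/N) = (ρ/u)(ρ/M)² = (ρ/u).  For u ≡ 2, 3 (mod 4) the same
-- congruence forces 4u ∣ N, so (ρ/u) only depends on b′ mod 24 ∈ R(A), and a finite check over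
-- R(A) contradicts the given value of χ₂.  The element 0 of S_{2,u} is excluded because a packing
-- containing a line contains a circle of curvature ±1 (f_C of a line has discriminant 0 and
-- represents a common divisor of the whole packing).  Finally u(24k)² ≡ 0 (mod 24), and 0 ∈ R(A).

{-# OPTIONS --safe #-}
module Submission where

open import Defs

open import Data.Bool using (true; false; T)
open import Data.Bool.ListAction using (any)
open import Data.Empty using (⊥; ⊥-elim)
open import Data.Integer as ℤ using (ℤ; +_; -[1+_]; ∣_∣; 1ℤ; -1ℤ; 0ℤ; _^_)
open import Data.Integer.DivMod using (_%ℕ_; _/ℕ_; a≡a%ℕn+[a/ℕn]*n; n%ℕd<d)
open import Data.Integer.Divisibility.Signed as ℤ∣ using (∣ᵤ⇒∣; ∣⇒∣ᵤ) renaming (_∣_ to _∣ℤ_)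
import Data.Integer.Properties as ℤ
open import Data.Integer.Solver using (module +-*-Solver)
open import Data.Integer.Tactic.RingSolver using (solve-∀)
open import Data.List using (List; upTo)
open import Data.List.Membership.Propositional using (_∈_; _∉_)
open import Data.List.Relation.Unary.All as All using (All; all?)
open import Data.Nat as ℕ using (ℕ; zero; suc; _≤_; _<_; _≤?_; z≤n; s≤s; NonZero; _≡ᵇ_)
open import Data.Nat.Coprimality as Coprime
  using (Coprime; 0-coprimeTo-m⇒m≡1; 1-coprimeTo; coprime-/gcd; coprime-Bézout)
open import Data.Nat.Divisibility as ℕ∣
  using (divides; ∣-refl; ∣-trans; _∣?_; m%n≡0⇒n∣m; n∣m⇒m%n≡0) renaming (_∣_ to _∣ℕ_; _∤_ to _∤ℕ_)
open import Data.Nat.DivMod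
  using ( _/_; _%_; [m+kn]%n≡m%n; %-distribˡ-*; m%n<n; m%n%n≡m%n; m%n≤m; m∣n⇒o%n%m≡o%m
        ; m/n<m; m*n/n≡m; *-/-assoc; m*[n/m]≡n; m≥n⇒m/n>0)
open import Data.Nat.GCD using (gcd; gcd[m,n]∣m; gcd[m,n]∣n; gcd[m,n]≢0; module Bézout)
open import Data.Nat.Induction using (<-wellFounded)
open import Data.Nat.Primality
  using ( Prime; prime?; prime⇒nonTrivial; prime⇒nonZero; prime⇒irreducible; euclidsLemma
        ; _Rough_; 2-rough; ∤⇒rough-suc; rough∧∣⇒rough; rough∧∣⇒prime)
import Data.Nat.Properties as ℕ
open import Data.Product using (∃; ∃-syntax; _×_; _,_; proj₁; proj₂)
open import Data.Sum as Sum using (_⊎_; inj₁; inj₂)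
open import Function using (_∘_)
open import Function.Bundles using (Equivalence)
open import Induction.WellFounded using (Acc; acc)
open import Relation.Binary.PropositionalEquality
open import Relation.Nullary using (¬_; Dec; yes; no; ¬?; _×-dec_; _⊎-dec_; _→-dec_)
open import Relation.Nullary.Decidable using (True; toWitness)
open import Relation.Unary using (Decidable)

open import Algebra.Properties.CommutativeSemigroup ℤ.*-commutativeSemigroup using (x∙yz≈y∙xz; interchange)
open import Data.List.Membership.DecPropositional ℕ._≟_ using (_∈?_)

record LeastDivisor (m p : ℕ) : Set where
  field
    nontrivial : 1 < p
    divisor    : p ∣ℕ m
    rough      : p Rough m

  instance
    nonZero : NonZero p
    nonZero = ℕ.>-nonZero (ℕ.<-trans (s≤s z≤n) nontrivial)

firstDivFrom-least : ∀ f k {m} → 1 < m → m ≤ f ℕ.+ suc (suc k) → suc (suc k) Rough m →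
                     LeastDivisor m (firstDivFrom f k m)
firstDivFrom-least zero k 1<m m≤k+2 rough = record
  { nontrivial = 1<m
  ; divisor    = ∣-refl
  ; rough      = λ d → rough (ℕ∣.hasNonTrivialDivisor-≤ d m≤k+2)
  }
firstDivFrom-least (suc f) k {m} 1<m m≤ rough with m % suc (suc k) ≡ᵇ 0 in eq
... | true  = record
  { nontrivial = s≤s (s≤s z≤n)
  ; divisor    = m%n≡0⇒n∣m m _ (ℕ.≡ᵇ⇒≡ _ 0 (subst T (sym eq) _))
  ; rough      = rough
  }
... | false = firstDivFrom-least f (suc k) 1<m (subst (m ≤_) (sym (ℕ.+-suc f _)) m≤) (∤⇒rough-suc k+2∤m rough)
  where
  k+2∤m : suc (suc k) ∤ℕ m
  k+2∤m k+2∣m = subst T eq (ℕ.≡⇒≡ᵇ _ 0 (n∣m⇒m%n≡0 m _ k+2∣m))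

minPrimeFactor-least : ∀ {m} → 1 < m → LeastDivisor m (minPrimeFactor m)
minPrimeFactor-least {m} 1<m = firstDivFrom-least m 0 1<m (ℕ.m≤m+n m 2) 2-rough

leastDivisor-minimal : ∀ {m p q} → LeastDivisor m p → 1 < q → q ∣ℕ m → p ≤ q
leastDivisor-minimal least 1<q q∣m = ℕ.≮⇒≥ λ q<p →
  LeastDivisor.rough least (ℕ∣.hasNonTrivialDivisor {{ℕ.n>1⇒nonTrivial 1<q}} q<p q∣m)

leastDivisor-unique : ∀ {m p q} → LeastDivisor m p → LeastDivisor m q → p ≡ q
leastDivisor-unique lp lq = ℕ.≤-antisym
  (leastDivisor-minimal lp (LeastDivisor.nontrivial lq) (LeastDivisor.divisor lq))
  (leastDivisor-minimal lq (LeastDivisor.nontrivial lp) (LeastDivisor.divisor lp))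

leastDivisor-prime : ∀ {m p} → LeastDivisor m p → Prime p
leastDivisor-prime (record { nontrivial = 1<p ; divisor = p∣m ; rough = rough }) =
  rough∧∣⇒prime {{ℕ.n>1⇒nonTrivial 1<p}} rough p∣m

prime>1 : ∀ {p} → Prime p → 1 < p
prime>1 {p} pp = ℕ.nonTrivial⇒n>1 p {{prime⇒nonTrivial pp}}

-- The Kronecker symbol

-- (a / m) for m ≥ 1; `kronecker a (+ m)` reduces to it
kronecker⁺ : ℤ → ℕ → ℤ
kronecker⁺ a m = kronPos m a m

minPrimeFactor>1 : ∀ k → 1 < minPrimeFactor (suc (suc k))
minPrimeFactor>1 k = LeastDivisor.nontrivial (minPrimeFactor-least {suc (suc k)} (s≤s (s≤s z≤n)))

kronPos-fuel : ∀ f g a m → m ≤ f → m ≤ g → kronPos f a m ≡ kronPos g a m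
kronPos-fuel zero    zero    a zero _ _ = refl
kronPos-fuel zero    (suc g) a zero _ _ = refl
kronPos-fuel (suc f) zero    a zero _ _ = refl
kronPos-fuel (suc f) (suc g) a zero _ _ = refl
kronPos-fuel (suc f) (suc g) a (suc zero) _ _ = refl
kronPos-fuel (suc f) (suc g) a (suc (suc k)) (s≤s m≤f) (s≤s m≤g) with minPrimeFactor (suc (suc k)) in eq
... | zero   = refl
... | suc p′ = cong (symAtPrime a (suc p′) ℤ.*_) (kronPos-fuel f g a _ (m/p≤ m≤f) (m/p≤ m≤g))
  where
  m/p≤ : ∀ {f} → suc k ≤ f → suc (suc k) / suc p′ ≤ f
  m/p≤ m≤f = ℕ.<⇒≤pred (ℕ.<-≤-trans (m/n<m _ _ (subst (1 <_) eq (minPrimeFactor>1 k))) (s≤s m≤f))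

kronecker⁺-step : ∀ a {m p} .{{_ : NonZero p}} → 1 < m → LeastDivisor m p →
                  kronecker⁺ a m ≡ symAtPrime a p ℤ.* kronecker⁺ a (m / p)
kronecker⁺-step a {suc zero} (s≤s ()) _
kronecker⁺-step a {suc (suc k)} 1<m least
  with minPrimeFactor (suc (suc k)) in eq | leastDivisor-unique least (minPrimeFactor-least 1<m)
... | suc p′ | refl = cong (symAtPrime a (suc p′) ℤ.*_)
  (kronPos-fuel _ _ a _ (ℕ.<⇒≤pred (m/n<m _ _ (LeastDivisor.nontrivial least))) ℕ.≤-refl)

∣%ℕ⇒∣ : ∀ a {p d} .{{_ : NonZero d}} → p ∣ℕ d → p ∣ℕ a %ℕ d → p ∣ℕ ∣ a ∣
∣%ℕ⇒∣ a {p} {d} p∣d p∣r = ∣⇒∣ᵤ (subst (+ p ∣ℤ_) (sym (a≡a%ℕn+[a/ℕn]*n a d))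
  (ℤ∣.∣m∣n⇒∣m+n (∣ᵤ⇒∣ {i = + (a %ℕ d)} p∣r) (ℤ∣.∣n⇒∣m*n (a /ℕ d) (∣ᵤ⇒∣ {i = + d} p∣d))))

%ℕ-preserves-∤ : ∀ a {p d} .{{_ : NonZero d}} → p ∣ℕ d → ¬ p ∣ℕ ∣ a ∣ → ¬ p ∣ℕ a %ℕ d
%ℕ-preserves-∤ a p∣d p∤a p∣r = p∤a (∣%ℕ⇒∣ a p∣d p∣r)

symAtPrime-square : ∀ a {p} → Prime p → ¬ p ∣ℕ ∣ a ∣ → symAtPrime a p ℤ.* symAtPrime a p ≡ 1ℤ
symAtPrime-square a {0} pp _ with () ← prime>1 pp
symAtPrime-square a {1} pp _ with s≤s () ← prime>1 pp
symAtPrime-square a {2} _ 2∤a with a %ℕ 8 | n%ℕd<d a 8 | %ℕ-preserves-∤ a (divides 4 refl) 2∤a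
... | 0 | _ | odd = ⊥-elim (odd (divides 0 refl))
... | 1 | _ | _   = refl
... | 2 | _ | odd = ⊥-elim (odd (divides 1 refl))
... | 3 | _ | _   = refl
... | 4 | _ | odd = ⊥-elim (odd (divides 2 refl))
... | 5 | _ | _   = refl
... | 6 | _ | odd = ⊥-elim (odd (divides 3 refl))
... | 7 | _ | _   = refl
... | suc (suc (suc (suc (suc (suc (suc (suc _))))))) | s≤s (s≤s (s≤s (s≤s (s≤s (s≤s (s≤s (s≤s ()))))))) | _
symAtPrime-square a {p@(suc (suc (suc _)))} _ p∤a with a %ℕ p ≡ᵇ 0 in r
... | true  = ⊥-elim (%ℕ-preserves-∤ a ∣-refl p∤a (subst (p ∣ℕ_) (sym (ℕ.≡ᵇ⇒≡ _ 0 (subst T (sym r) _))) (p ℕ∣.∣0)))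
... | false with any (λ x → ((x ℕ.* x) % p) ≡ᵇ (a %ℕ p)) (upTo p)
...   | true  = refl
...   | false = refl

module _ (a : ℤ) where

  private
    χ : ℕ → ℤ
    χ = kronecker⁺ a
    σ : ℕ → ℤ
    σ = symAtPrime a

  kronecker⁺-*-prime : ∀ {p} → Prime p → ∀ k → 1 ≤ k → kronecker⁺ a (p ℕ.* k) ≡ symAtPrime a p ℤ.* kronecker⁺ a k
  kronecker⁺-*-prime {p} pp k 1≤k = go k 1≤k (<-wellFounded k)
    where
    instance
      p≢0 : NonZero p
      p≢0 = prime⇒nonZero pp
    go : ∀ k → 1 ≤ k → Acc _<_ k → χ (p ℕ.* k) ≡ σ p ℤ.* χ k
    go k 1≤k (acc rec) = via (minPrimeFactor-least 1<pk)
      where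
      instance
        k≢0 : NonZero k
        k≢0 = ℕ.>-nonZero 1≤k
      1<pk : 1 < p ℕ.* k
      1<pk = ℕ.<-≤-trans (prime>1 pp) (ℕ.m≤m*n p k)
      via : ∀ {q} → LeastDivisor (p ℕ.* k) q → χ (p ℕ.* k) ≡ σ p ℤ.* χ k
      via {q} least with q ℕ.≟ p
      ... | yes refl = trans (kronecker⁺-step a 1<pk least) (cong (λ t → σ p ℤ.* χ t) pk/p≡k)
        where
        pk/p≡k : p ℕ.* k / p ≡ k
        pk/p≡k = trans (cong (_/ p) (ℕ.*-comm p k)) (m*n/n≡m k p)
      ... | no q≢p = begin
        χ (p ℕ.* k)                    ≡⟨ kronecker⁺-step a 1<pk least ⟩
        σ q ℤ.* χ (p ℕ.* k / q)        ≡⟨ cong (λ t → σ q ℤ.* χ t) (*-/-assoc p q∣k) ⟩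
        σ q ℤ.* χ (p ℕ.* (k / q))      ≡⟨ cong (σ q ℤ.*_) (go (k / q) (m≥n⇒m/n>0 q≤k) (rec (m/n<m k q 1<q))) ⟩
        σ q ℤ.* (σ p ℤ.* χ (k / q))    ≡⟨ x∙yz≈y∙xz (σ q) (σ p) _ ⟩
        σ p ℤ.* (σ q ℤ.* χ (k / q))    ≡⟨ cong (σ p ℤ.*_) (kronecker⁺-step a (ℕ.<-≤-trans 1<q q≤k) least-k) ⟨
        σ p ℤ.* χ k                    ∎
        where
        open ≡-Reasoning
        open LeastDivisor least renaming (nontrivial to 1<q)
        q∣k : q ∣ℕ k
        q∣k with euclidsLemma p k (leastDivisor-prime least) divisor
        ... | inj₂ q∣k = q∣k
        ... | inj₁ q∣p with prime⇒irreducible pp q∣p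
        ...   | inj₁ refl = ⊥-elim (ℕ.<-irrefl refl 1<q)
        ...   | inj₂ q≡p  = ⊥-elim (q≢p q≡p)
        q≤k : q ≤ k
        q≤k = ℕ∣.∣⇒≤ q∣k
        least-k : LeastDivisor k q
        least-k = record { nontrivial = 1<q ; divisor = q∣k ; rough = rough∧∣⇒rough rough (ℕ∣.n∣m*n p) }

  kronecker⁺-* : ∀ m k → 1 ≤ m → 1 ≤ k → kronecker⁺ a (m ℕ.* k) ≡ kronecker⁺ a m ℤ.* kronecker⁺ a k
  kronecker⁺-* m k 1≤m 1≤k = go m 1≤m (<-wellFounded m)
    where
    go : ∀ m → 1 ≤ m → Acc _<_ m → χ (m ℕ.* k) ≡ χ m ℤ.* χ k
    go (suc zero) _ _ = trans (cong χ (ℕ.*-identityˡ k)) (sym (ℤ.*-identityˡ _))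
    go m@(suc (suc _)) _ (acc rec) = begin
      χ (m ℕ.* k)                    ≡⟨ cong χ m*k≡q*[m/q*k] ⟩
      χ (q ℕ.* (m / q ℕ.* k))        ≡⟨ kronecker⁺-*-prime (leastDivisor-prime least) _ (ℕ.*-mono-≤ 1≤m/q 1≤k) ⟩
      σ q ℤ.* χ (m / q ℕ.* k)        ≡⟨ cong (σ q ℤ.*_) (go (m / q) 1≤m/q (rec (m/n<m m q 1<q))) ⟩
      σ q ℤ.* (χ (m / q) ℤ.* χ k)    ≡⟨ ℤ.*-assoc (σ q) _ _ ⟨
      σ q ℤ.* χ (m / q) ℤ.* χ k      ≡⟨ cong (ℤ._* χ k) (kronecker⁺-step a (s≤s (s≤s z≤n)) least) ⟨
      χ m ℤ.* χ k                    ∎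
      where
      open ≡-Reasoning
      q = minPrimeFactor m
      least : LeastDivisor m q
      least = minPrimeFactor-least (s≤s (s≤s z≤n))
      open LeastDivisor least renaming (nontrivial to 1<q)
      1≤m/q : 1 ≤ m / q
      1≤m/q = m≥n⇒m/n>0 (ℕ∣.∣⇒≤ divisor)
      m*k≡q*[m/q*k] : m ℕ.* k ≡ q ℕ.* (m / q ℕ.* k)
      m*k≡q*[m/q*k] = trans (cong (ℕ._* k) (sym (m*[n/m]≡n divisor))) (ℕ.*-assoc q (m / q) k)

  kronecker⁺-square : ∀ m → Coprime ∣ a ∣ m → kronecker⁺ a m ℤ.* kronecker⁺ a m ≡ 1ℤ
  kronecker⁺-square m coprime = go m coprime (<-wellFounded m)
    where
    go : ∀ m → Coprime ∣ a ∣ m → Acc _<_ m → χ m ℤ.* χ m ≡ 1ℤ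
    go zero          _ _ = refl
    go (suc zero)    _ _ = refl
    go m@(suc (suc _)) coprime (acc rec) = begin
      χ m ℤ.* χ m                                    ≡⟨ cong₂ ℤ._*_ step step ⟩
      (σ q ℤ.* χ (m / q)) ℤ.* (σ q ℤ.* χ (m / q))    ≡⟨ interchange (σ q) _ (σ q) _ ⟩
      (σ q ℤ.* σ q) ℤ.* (χ (m / q) ℤ.* χ (m / q))    ≡⟨ cong₂ ℤ._*_ σ²≡1 (go (m / q) coprime′ (rec (m/n<m m q 1<q))) ⟩
      1ℤ                                             ∎
      where
      open ≡-Reasoning
      q = minPrimeFactor m
      least : LeastDivisor m q
      least = minPrimeFactor-least (s≤s (s≤s z≤n))
      open LeastDivisor least renaming (nontrivial to 1<q)
      step : χ m ≡ σ q ℤ.* χ (m / q)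
      step = kronecker⁺-step a (s≤s (s≤s z≤n)) least
      σ²≡1 : σ q ℤ.* σ q ≡ 1ℤ
      σ²≡1 = symAtPrime-square a (leastDivisor-prime least) λ q∣a → ℕ.<-irrefl (sym (coprime (q∣a , divisor))) 1<q
      coprime′ : Coprime ∣ a ∣ (m / q)
      coprime′ (i∣a , i∣m/q) = coprime (i∣a , ∣-trans i∣m/q (ℕ∣.m/n∣m divisor))

  kronecker⁺-*-square : ∀ u M → 1 ≤ u → 1 ≤ M → Coprime ∣ a ∣ M → kronecker⁺ a (u ℕ.* (M ℕ.* M)) ≡ kronecker⁺ a u
  kronecker⁺-*-square u M 1≤u 1≤M coprime = begin
    χ (u ℕ.* (M ℕ.* M))          ≡⟨ kronecker⁺-* u (M ℕ.* M) 1≤u (ℕ.*-mono-≤ 1≤M 1≤M) ⟩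
    χ u ℤ.* χ (M ℕ.* M)          ≡⟨ cong (χ u ℤ.*_) (kronecker⁺-* M M 1≤M 1≤M) ⟩
    χ u ℤ.* (χ M ℤ.* χ M)        ≡⟨ cong (χ u ℤ.*_) (kronecker⁺-square M coprime) ⟩
    χ u ℤ.* 1ℤ                   ≡⟨ ℤ.*-identityʳ _ ⟩
    χ u                          ∎
    where open ≡-Reasoning

∸-multiple⇒%≡ : ∀ {m n d} .{{_ : NonZero d}} → n ≤ m → d ∣ℕ m ℕ.∸ n → m % d ≡ n % d
∸-multiple⇒%≡ {m} {n} {d} n≤m (divides k m∸n≡k*d) = begin
  m % d                   ≡⟨ cong (_% d) (ℕ.m+[n∸m]≡n n≤m) ⟨
  (n ℕ.+ (m ℕ.∸ n)) % d   ≡⟨ cong (λ t → (n ℕ.+ t) % d) m∸n≡k*d ⟩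
  (n ℕ.+ k ℕ.* d) % d     ≡⟨ [m+kn]%n≡m%n n k d ⟩
  n % d                   ∎
  where open ≡-Reasoning

∣+m-+n∣≡m∸n : ∀ {m n} → n ≤ m → ∣ + m ℤ.- + n ∣ ≡ m ℕ.∸ n
∣+m-+n∣≡m∸n {m} {n} n≤m = cong ∣_∣ (trans (ℤ.[+m]-[+n]≡m⊖n m n) (ℤ.⊖-≥ n≤m))

∣-sub⇒%≡ : ∀ m n d .{{_ : NonZero d}} → + d ∣ℤ + m ℤ.- + n → m % d ≡ n % d
∣-sub⇒%≡ m n d d∣m-n with ℕ.≤-total n m
... | inj₁ n≤m = ∸-multiple⇒%≡ n≤m (subst (d ∣ℕ_) (∣+m-+n∣≡m∸n n≤m) (∣⇒∣ᵤ d∣m-n))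
... | inj₂ m≤n = sym (∸-multiple⇒%≡ m≤n (subst (d ∣ℕ_) ∣m-n∣≡n∸m (∣⇒∣ᵤ d∣m-n)))
  where
  ∣m-n∣≡n∸m : ∣ + m ℤ.- + n ∣ ≡ n ℕ.∸ m
  ∣m-n∣≡n∸m = trans (ℤ.∣i-j∣≡∣j-i∣ (+ m) (+ n)) (∣+m-+n∣≡m∸n m≤n)

symAtPrime-periodic : ∀ p {ρ r} → + (4 ℕ.* p) ∣ℤ + ρ ℤ.- + r → symAtPrime (+ ρ) p ≡ symAtPrime (+ r) p
symAtPrime-periodic 0 _ = refl
symAtPrime-periodic 1 _ = refl
symAtPrime-periodic 2 {ρ} {r} 8∣ρ-r rewrite ∣-sub⇒%≡ ρ r 8 8∣ρ-r = refl
symAtPrime-periodic p@(suc (suc (suc _))) {ρ} {r} 4p∣ρ-r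
  rewrite ∣-sub⇒%≡ ρ r p (ℤ∣.∣-trans (ℤ∣.∣n⇒∣m*n (+ 4) (ℤ∣.∣-refl {+ p})) 4p∣ρ-r) = refl

kronecker⁺-periodic : ∀ m {ρ r} → + (4 ℕ.* m) ∣ℤ + ρ ℤ.- + r → kronecker⁺ (+ ρ) m ≡ kronecker⁺ (+ r) m
kronecker⁺-periodic m {ρ} {r} 4m∣ρ-r = go m ∣-refl (<-wellFounded m)
  where
  go : ∀ k → k ∣ℕ m → Acc _<_ k → kronecker⁺ (+ ρ) k ≡ kronecker⁺ (+ r) k
  go zero          _ _ = refl
  go (suc zero)    _ _ = refl
  go k@(suc (suc _)) k∣m (acc rec) = begin
    kronecker⁺ (+ ρ) k                                ≡⟨ kronecker⁺-step (+ ρ) (s≤s (s≤s z≤n)) least ⟩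
    symAtPrime (+ ρ) q ℤ.* kronecker⁺ (+ ρ) (k / q)   ≡⟨ cong₂ ℤ._*_ (symAtPrime-periodic q (4d∣ρ-r q∣m)) ih ⟩
    symAtPrime (+ r) q ℤ.* kronecker⁺ (+ r) (k / q)   ≡⟨ kronecker⁺-step (+ r) (s≤s (s≤s z≤n)) least ⟨
    kronecker⁺ (+ r) k                                ∎
    where
    open ≡-Reasoning
    q = minPrimeFactor k
    least : LeastDivisor k q
    least = minPrimeFactor-least (s≤s (s≤s z≤n))
    open LeastDivisor least renaming (nontrivial to 1<q)
    q∣m : q ∣ℕ m
    q∣m = ∣-trans divisor k∣m
    4d∣ρ-r : ∀ {d} → d ∣ℕ m → + (4 ℕ.* d) ∣ℤ + ρ ℤ.- + r
    4d∣ρ-r d∣m = ℤ∣.∣-trans (∣ᵤ⇒∣ (ℕ∣.*-monoʳ-∣ 4 d∣m)) 4m∣ρ-r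
    ih : kronecker⁺ (+ ρ) (k / q) ≡ kronecker⁺ (+ r) (k / q)
    ih = go (k / q) (∣-trans (ℕ∣.m/n∣m divisor) k∣m) (rec (m/n<m k q 1<q))

chiSymbol≡kronecker⁺ : ∀ N ρ → 1 ≤ N → N % 4 ≤ 1 → chiSymbol (+ N) ρ ≡ kronecker⁺ (+ ρ) N
chiSymbol≡kronecker⁺ (suc N) ρ _ N%4≤1 with suc N % 4 | N%4≤1
... | 0 | _ = refl
... | 1 | _ = refl
... | suc (suc _) | s≤s ()

descartesForm : ℤ → ℤ → ℤ → ℤ → ℤ
descartesForm a b c d = (a ℤ.+ b ℤ.+ c ℤ.+ d) ^ 2 ℤ.- + 2 ℤ.* (a ^ 2 ℤ.+ b ^ 2 ℤ.+ c ^ 2 ℤ.+ d ^ 2)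

form : ℤ → ℤ → ℤ → ℤ → ℤ → ℤ
form α β γ x y = α ℤ.* x ℤ.* x ℤ.+ β ℤ.* x ℤ.* y ℤ.+ γ ℤ.* y ℤ.* y

reflect : ℤ → ℤ → ℤ → ℤ → ℤ
reflect x y z a = + 2 ℤ.* (x ℤ.+ y ℤ.+ z) ℤ.- a

module _ where
  open +-*-Solver

  private
    descartesₚ : ∀ {n} → Polynomial n → Polynomial n → Polynomial n → Polynomial n → Polynomial n
    descartesₚ a b c d = (a :+ b :+ c :+ d) :^ 2 :- con (+ 2) :* (a :^ 2 :+ b :^ 2 :+ c :^ 2 :+ d :^ 2)

    reflectₚ : ∀ {n} → Polynomial n → Polynomial n → Polynomial n → Polynomial n → Polynomial n
    reflectₚ x y z a = con (+ 2) :* (x :+ y :+ z) :- a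

    formₚ : ∀ {n} → Polynomial n → Polynomial n → Polynomial n → Polynomial n → Polynomial n → Polynomial n
    formₚ α β γ x y = α :* x :* x :+ β :* x :* y :+ γ :* y :* y

    fCₚ : ∀ {k} → Polynomial k → Polynomial k → Polynomial k → Polynomial k → Polynomial k → Polynomial k →
          Polynomial k
    fCₚ n b c d = formₚ (n :+ b) (n :+ b :+ c :- d) (n :+ c)

  reflect-involutive : ∀ x y z a → reflect x y z (reflect x y z a) ≡ a
  reflect-involutive = solve 4 (λ x y z a → reflectₚ x y z (reflectₚ x y z a) := a) refl

  descartesForm-s₁ : ∀ a b c d → descartesForm (reflect b c d a) b c d ≡ descartesForm a b c d
  descartesForm-s₁ = solve 4 (λ a b c d → descartesₚ (reflectₚ b c d a) b c d := descartesₚ a b c d) refl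

  descartesForm-s₂ : ∀ a b c d → descartesForm a (reflect a c d b) c d ≡ descartesForm a b c d
  descartesForm-s₂ = solve 4 (λ a b c d → descartesₚ a (reflectₚ a c d b) c d := descartesₚ a b c d) refl

  descartesForm-s₃ : ∀ a b c d → descartesForm a b (reflect a b d c) d ≡ descartesForm a b c d
  descartesForm-s₃ = solve 4 (λ a b c d → descartesₚ a b (reflectₚ a b d c) d := descartesₚ a b c d) refl

  descartesForm-s₄ : ∀ a b c d → descartesForm a b c (reflect a b c d) ≡ descartesForm a b c d
  descartesForm-s₄ = solve 4 (λ a b c d → descartesₚ a b c (reflectₚ a b c d) := descartesₚ a b c d) refl

  descartesForm-swap₁₂ : ∀ a b c d → descartesForm b a c d ≡ descartesForm a b c d
  descartesForm-swap₁₂ = solve 4 (λ a b c d → descartesₚ b a c d := descartesₚ a b c d) refl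

  descartesForm-swap₂₃ : ∀ a b c d → descartesForm a c b d ≡ descartesForm a b c d
  descartesForm-swap₂₃ = solve 4 (λ a b c d → descartesₚ a c b d := descartesₚ a b c d) refl

  descartesForm-swap₃₄ : ∀ a b c d → descartesForm a b d c ≡ descartesForm a b c d
  descartesForm-swap₃₄ = solve 4 (λ a b c d → descartesₚ a b d c := descartesₚ a b c d) refl

  fC-1-0 : ∀ n b c d → fC n b c d 1ℤ 0ℤ ≡ n ℤ.+ b
  fC-1-0 = solve 4 (λ n b c d → fCₚ n b c d (con 1ℤ) (con 0ℤ) := n :+ b) refl

  fC-swap : ∀ n b c d x y → fC n b c d x y ≡ fC n c b d y x
  fC-swap = solve 6 (λ n b c d x y → fCₚ n b c d x y := fCₚ n c b d y x) refl

  fC-shear : ∀ n b c d x y → fC n b c d (x ℤ.+ y) y ≡ fC n b (reflect n b c d) c x y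
  fC-shear = solve 6 (λ n b c d x y → fCₚ n b c d (x :+ y) y := fCₚ n b (reflectₚ n b c d) c x y) refl

  fC-neg : ∀ n b c d x y → fC n b c d (ℤ.- x) (ℤ.- y) ≡ fC n b c d x y
  fC-neg = solve 6 (λ n b c d x y → fCₚ n b c d (:- x) (:- y) := fCₚ n b c d x y) refl

  fC-reflect : ∀ n b c d x y → fC n b c d x (ℤ.- y) ≡ fC n b c (reflect n b c d) x y
  fC-reflect = solve 6 (λ n b c d x y → fCₚ n b c d x (:- y) := fCₚ n b c (reflectₚ n b c d) x y) refl

  fC-reflect′ : ∀ n b c d x y → fC n b c d (ℤ.- x) y ≡ fC n b c (reflect n b c d) x y
  fC-reflect′ = solve 6 (λ n b c d x y → fCₚ n b c d (:- x) y := fCₚ n b c (reflectₚ n b c d) x y) refl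

  form-swap : ∀ α β γ x y → form α β γ x y ≡ form γ β α y x
  form-swap = solve 5 (λ α β γ x y → formₚ α β γ x y := formₚ γ β α y x) refl

  form-0-1 : ∀ β γ → form 0ℤ β γ 0ℤ 1ℤ ≡ γ
  form-0-1 = solve 2 (λ β γ → formₚ (con 0ℤ) β γ (con 0ℤ) (con 1ℤ) := γ) refl

  form-complete-square : ∀ α β γ x y →
    + 4 ℤ.* α ℤ.* form α β γ x y ≡ (+ 2 ℤ.* α ℤ.* x ℤ.+ β ℤ.* y) ℤ.* (+ 2 ℤ.* α ℤ.* x ℤ.+ β ℤ.* y)
                                   ℤ.+ (+ 4 ℤ.* α ℤ.* γ ℤ.- β ℤ.* β) ℤ.* y ℤ.* y
  form-complete-square = solve 5 (λ α β γ x y → con (+ 4) :* α :* formₚ α β γ x y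
    := (con (+ 2) :* α :* x :+ β :* y) :* (con (+ 2) :* α :* x :+ β :* y)
       :+ (con (+ 4) :* α :* γ :- β :* β) :* y :* y) refl

  fC-discriminant : ∀ n b c d →
    (n ℤ.+ b ℤ.+ c ℤ.- d) ℤ.* (n ℤ.+ b ℤ.+ c ℤ.- d) ℤ.- + 4 ℤ.* (n ℤ.+ b) ℤ.* (n ℤ.+ c)
      ≡ ℤ.- (+ 4 ℤ.* n ℤ.* n) ℤ.- descartesForm n b c d
  fC-discriminant = solve 4 (λ n b c d →
    (n :+ b :+ c :- d) :* (n :+ b :+ c :- d) :- con (+ 4) :* (n :+ b) :* (n :+ c)
      := :- (con (+ 4) :* n :* n) :- descartesₚ n b c d) refl

Descartes : Quad → Set
Descartes (quad a b c d) = descartesForm a b c d ≡ 0ℤ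

reachable-descartes : ∀ {A q} → Reachable A q → Descartes q
reachable-descartes {A} root = trans (cong (ℤ._- 2Σ) (Packing.descartes A)) (ℤ.+-inverseʳ 2Σ)
  where
  open Quad (Packing.root A)
  2Σ = + 2 ℤ.* (q₁ ^ 2 ℤ.+ q₂ ^ 2 ℤ.+ q₃ ^ 2 ℤ.+ q₄ ^ 2)
reachable-descartes (s₁ {a} {b} {c} {d} r) = trans (descartesForm-s₁ a b c d) (reachable-descartes r)
reachable-descartes (s₂ {a} {b} {c} {d} r) = trans (descartesForm-s₂ a b c d) (reachable-descartes r)
reachable-descartes (s₃ {a} {b} {c} {d} r) = trans (descartesForm-s₃ a b c d) (reachable-descartes r)
reachable-descartes (s₄ {a} {b} {c} {d} r) = trans (descartesForm-s₄ a b c d) (reachable-descartes r)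
reachable-descartes (swap₁₂ {a} {b} {c} {d} r) = trans (descartesForm-swap₁₂ a b c d) (reachable-descartes r)
reachable-descartes (swap₂₃ {a} {b} {c} {d} r) = trans (descartesForm-swap₂₃ a b c d) (reachable-descartes r)
reachable-descartes (swap₃₄ {a} {b} {c} {d} r) = trans (descartesForm-swap₃₄ a b c d) (reachable-descartes r)

CommonDivisor : ℤ → Quad → Set
CommonDivisor g (quad a b c d) = g ∣ℤ a × g ∣ℤ b × g ∣ℤ c × g ∣ℤ d

module _ {g : ℤ} where

  ∣-reflect : ∀ {x y z a} → g ∣ℤ x → g ∣ℤ y → g ∣ℤ z → g ∣ℤ a → g ∣ℤ reflect x y z a
  ∣-reflect g∣x g∣y g∣z g∣a =
    ℤ∣.∣m∣n⇒∣m-n (ℤ∣.∣n⇒∣m*n (+ 2) (ℤ∣.∣m∣n⇒∣m+n (ℤ∣.∣m∣n⇒∣m+n g∣x g∣y) g∣z)) g∣a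

  ∣-reflect⁻¹ : ∀ {x y z a} → g ∣ℤ x → g ∣ℤ y → g ∣ℤ z → g ∣ℤ reflect x y z a → g ∣ℤ a
  ∣-reflect⁻¹ {x} {y} {z} {a} g∣x g∣y g∣z g∣r =
    subst (g ∣ℤ_) (reflect-involutive x y z a) (∣-reflect g∣x g∣y g∣z g∣r)

  module _ {A : Packing} where

    common-divisor-root : ∀ {q} → Reachable A q → CommonDivisor g q → CommonDivisor g (Packing.root A)
    common-divisor-root root       g∣q                   = g∣q
    common-divisor-root (s₁ r)     (g∣a , g∣b , g∣c , g∣d) = common-divisor-root r (∣-reflect⁻¹ g∣b g∣c g∣d g∣a , g∣b , g∣c , g∣d)
    common-divisor-root (s₂ r)     (g∣a , g∣b , g∣c , g∣d) = common-divisor-root r (g∣a , ∣-reflect⁻¹ g∣a g∣c g∣d g∣b , g∣c , g∣d)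
    common-divisor-root (s₃ r)     (g∣a , g∣b , g∣c , g∣d) = common-divisor-root r (g∣a , g∣b , ∣-reflect⁻¹ g∣a g∣b g∣d g∣c , g∣d)
    common-divisor-root (s₄ r)     (g∣a , g∣b , g∣c , g∣d) = common-divisor-root r (g∣a , g∣b , g∣c , ∣-reflect⁻¹ g∣a g∣b g∣c g∣d)
    common-divisor-root (swap₁₂ r) (g∣a , g∣b , g∣c , g∣d) = common-divisor-root r (g∣b , g∣a , g∣c , g∣d)
    common-divisor-root (swap₂₃ r) (g∣a , g∣b , g∣c , g∣d) = common-divisor-root r (g∣a , g∣c , g∣b , g∣d)
    common-divisor-root (swap₃₄ r) (g∣a , g∣b , g∣c , g∣d) = common-divisor-root r (g∣a , g∣b , g∣d , g∣c)

    common-divisor-reachable : CommonDivisor g (Packing.root A) → ∀ {q} → Reachable A q → CommonDivisor g q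
    common-divisor-reachable g∣root root = g∣root
    common-divisor-reachable g∣root (s₁ r) with g∣a , g∣b , g∣c , g∣d ← common-divisor-reachable g∣root r =
      ∣-reflect g∣b g∣c g∣d g∣a , g∣b , g∣c , g∣d
    common-divisor-reachable g∣root (s₂ r) with g∣a , g∣b , g∣c , g∣d ← common-divisor-reachable g∣root r =
      g∣a , ∣-reflect g∣a g∣c g∣d g∣b , g∣c , g∣d
    common-divisor-reachable g∣root (s₃ r) with g∣a , g∣b , g∣c , g∣d ← common-divisor-reachable g∣root r =
      g∣a , g∣b , ∣-reflect g∣a g∣b g∣d g∣c , g∣d
    common-divisor-reachable g∣root (s₄ r) with g∣a , g∣b , g∣c , g∣d ← common-divisor-reachable g∣root r =
      g∣a , g∣b , g∣c , ∣-reflect g∣a g∣b g∣c g∣d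
    common-divisor-reachable g∣root (swap₁₂ r) with g∣a , g∣b , g∣c , g∣d ← common-divisor-reachable g∣root r =
      g∣b , g∣a , g∣c , g∣d
    common-divisor-reachable g∣root (swap₂₃ r) with g∣a , g∣b , g∣c , g∣d ← common-divisor-reachable g∣root r =
      g∣a , g∣c , g∣b , g∣d
    common-divisor-reachable g∣root (swap₃₄ r) with g∣a , g∣b , g∣c , g∣d ← common-divisor-reachable g∣root r =
      g∣a , g∣b , g∣d , g∣c

primitive-common-divisor : ∀ {A} → Primitive A → ∀ {q} → Reachable A q → ∀ {g} → CommonDivisor g q → ∣ g ∣ ≡ 1
primitive-common-divisor prim r {g} g∣q = prim ∣ g ∣ λ c (_ , _ , _ , r′) →
  ∣⇒∣ᵤ (proj₁ (common-divisor-reachable (common-divisor-root r g∣q) r′))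

fC-coefficients-∣ : ∀ {g n b c d} → g ∣ℤ n → g ∣ℤ n ℤ.+ b → g ∣ℤ n ℤ.+ b ℤ.+ c ℤ.- d → g ∣ℤ n ℤ.+ c →
                    CommonDivisor g (quad n b c d)
fC-coefficients-∣ {g} {n} {b} {c} {d} g∣n g∣n+b g∣n+b+c-d g∣n+c = g∣n , g∣b , g∣c , g∣d
  where
  b≡n+b-n : ∀ n b → b ≡ n ℤ.+ b ℤ.- n
  b≡n+b-n = solve-∀
  d≡n+b+c-[n+b+c-d] : ∀ n b c d → d ≡ n ℤ.+ b ℤ.+ c ℤ.- (n ℤ.+ b ℤ.+ c ℤ.- d)
  d≡n+b+c-[n+b+c-d] = solve-∀
  g∣b : g ∣ℤ b
  g∣b = subst (g ∣ℤ_) (sym (b≡n+b-n n b)) (ℤ∣.∣m∣n⇒∣m-n g∣n+b g∣n)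
  g∣c : g ∣ℤ c
  g∣c = subst (g ∣ℤ_) (sym (b≡n+b-n n c)) (ℤ∣.∣m∣n⇒∣m-n g∣n+c g∣n)
  g∣d : g ∣ℤ d
  g∣d = subst (g ∣ℤ_) (sym (d≡n+b+c-[n+b+c-d] n b c d)) (ℤ∣.∣m∣n⇒∣m-n (ℤ∣.∣m∣n⇒∣m+n g∣n+b g∣c) g∣n+b+c-d)

-- Euclid's algorithm as a chain of Apollonian moves

coprime-∸ : ∀ {m n} → n ≤ m → Coprime m n → Coprime (m ℕ.∸ n) n
coprime-∸ n≤m coprime (d∣m∸n , d∣n) = coprime (ℕ∣.∣m∸n∣n⇒∣m _ n≤m d∣m∸n d∣n , d∣n)

coprime-induction : ∀ {ℓ} {P : ℕ → ℕ → Set ℓ} → P 1 0 → (∀ {x y} → P x y → P y x) →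
                    (∀ {x y} → P x y → P (x ℕ.+ y) y) → ∀ x y → Coprime x y → P x y
coprime-induction {P = P} base swap shear x y coprime = go x y coprime (<-wellFounded (x ℕ.+ y))
  where
  go : ∀ x y → Coprime x y → Acc _<_ (x ℕ.+ y) → P x y
  go x zero coprime _ = subst (λ t → P t 0) (sym (coprime (∣-refl , x ℕ∣.∣0))) base
  go zero (suc y) coprime _ = swap (subst (λ t → P t 0) (sym (0-coprimeTo-m⇒m≡1 coprime)) base)
  go (suc x) (suc y) coprime (acc rec) with suc y ≤? suc x
  ... | yes y≤x = subst (λ t → P t (suc y)) (ℕ.m∸n+n≡m y≤x)
    (shear (go (suc x ℕ.∸ suc y) (suc y) (coprime-∸ y≤x coprime) (rec smaller)))
    where
    smaller : suc x ℕ.∸ suc y ℕ.+ suc y < suc x ℕ.+ suc y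
    smaller = subst (_< suc x ℕ.+ suc y) (sym (ℕ.m∸n+n≡m y≤x)) (ℕ.m<m+n (suc x) (s≤s z≤n))
  ... | no y≰x = swap (subst (λ t → P t (suc x)) (ℕ.m∸n+n≡m x≤y)
    (shear (go (suc y ℕ.∸ suc x) (suc x) (coprime-∸ x≤y (Coprime.sym coprime)) (rec smaller))))
    where
    x≤y : suc x ≤ suc y
    x≤y = ℕ.≰⇒≥ y≰x
    smaller : suc y ℕ.∸ suc x ℕ.+ suc x < suc x ℕ.+ suc y
    smaller = subst (_< suc x ℕ.+ suc y) (sym (ℕ.m∸n+n≡m x≤y)) (ℕ.m<n+m (suc y) (s≤s z≤n))

TangentValue : Packing → ℤ → ℤ → Set
TangentValue A n v = ∃[ b′ ] ∃[ c′ ] ∃[ d′ ] Reachable A (quad n b′ c′ d′) × v ≡ n ℤ.+ b′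

module _ {A : Packing} {n : ℤ} where

  fC-coprime-tangent : ∀ x y → Coprime x y → ∀ {b c d} → Reachable A (quad n b c d) →
                       TangentValue A n (fC n b c d (+ x) (+ y))
  fC-coprime-tangent = coprime-induction {P = TangentAt} base swap shear
    where
    TangentAt : ℕ → ℕ → Set
    TangentAt x y = ∀ {b c d} → Reachable A (quad n b c d) → TangentValue A n (fC n b c d (+ x) (+ y))
    base : TangentAt 1 0
    base {b} {c} {d} r = b , c , d , r , fC-1-0 n b c d
    swap : ∀ {x y} → TangentAt x y → TangentAt y x
    swap {x} {y} h {b} {c} {d} r = subst (TangentValue A n) (sym (fC-swap n b c d (+ y) (+ x))) (h (swap₂₃ r))
    shear : ∀ {x y} → TangentAt x y → TangentAt (x ℕ.+ y) y
    shear {x} {y} h {b} {c} {d} r = subst (TangentValue A n)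
      (sym (trans (cong (λ t → fC n b c d t (+ y)) (ℤ.pos-+ x y)) (fC-shear n b c d (+ x) (+ y))))
      (h (swap₃₄ (s₄ r)))

  fC-coprime-tangentℤ : ∀ x y → Coprime ∣ x ∣ ∣ y ∣ → ∀ {b c d} → Reachable A (quad n b c d) →
                        TangentValue A n (fC n b c d x y)
  fC-coprime-tangentℤ (+ x) (+ y) coprime r = fC-coprime-tangent x y coprime r
  fC-coprime-tangentℤ (+ x) -[1+ y ] coprime {b} {c} {d} r =
    subst (TangentValue A n) (sym (fC-reflect n b c d (+ x) (+ suc y))) (fC-coprime-tangent x (suc y) coprime (s₄ r))
  fC-coprime-tangentℤ -[1+ x ] (+ y) coprime {b} {c} {d} r =
    subst (TangentValue A n) (sym (fC-reflect′ n b c d (+ suc x) (+ y))) (fC-coprime-tangent (suc x) y coprime (s₄ r))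
  fC-coprime-tangentℤ -[1+ x ] -[1+ y ] coprime {b} {c} {d} r =
    subst (TangentValue A n) (sym (fC-neg n b c d (+ suc x) (+ suc y))) (fC-coprime-tangent (suc x) (suc y) coprime r)

no-common-prime⇒coprime : ∀ {m n} → 1 ≤ m → (∀ {p} → Prime p → p ∣ℕ m → p ∣ℕ n → ⊥) → Coprime m n
no-common-prime⇒coprime 1≤m _ {zero} (0∣m , _) = ⊥-elim (ℕ.<⇒≢ 1≤m (sym (ℕ∣.0∣⇒≡0 0∣m)))
no-common-prime⇒coprime _ _ {suc zero} _ = refl
no-common-prime⇒coprime _ none {i@(suc (suc _))} (i∣m , i∣n) =
  ⊥-elim (none (leastDivisor-prime least) (∣-trans divisor i∣m) (∣-trans divisor i∣n))
  where
  least = minPrimeFactor-least {i} (s≤s (s≤s z≤n))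
  open LeastDivisor least

module _ {p : ℕ} (pp : Prime p) where

  prime-∤-* : ∀ {i j} → ¬ + p ∣ℤ i → ¬ + p ∣ℤ j → ¬ + p ∣ℤ i ℤ.* j
  prime-∤-* {i} {j} p∤i p∤j p∣ij with euclidsLemma ∣ i ∣ ∣ j ∣ pp (subst (p ∣ℕ_) (ℤ.abs-* i j) (∣⇒∣ᵤ p∣ij))
  ... | inj₁ p∣i = p∤i (∣ᵤ⇒∣ p∣i)
  ... | inj₂ p∣j = p∤j (∣ᵤ⇒∣ p∣j)

  form-∤-y : ∀ {α β γ x y} → + p ∣ℤ y → ¬ + p ∣ℤ α → ¬ + p ∣ℤ x → ¬ + p ∣ℤ form α β γ x y
  form-∤-y {α} {β} {γ} {x} {y} p∣y p∤α p∤x p∣F = prime-∤-* (prime-∤-* p∤α p∤x) p∤x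
    (ℤ∣.∣m+n∣n⇒∣m (ℤ∣.∣m+n∣n⇒∣m p∣F (ℤ∣.∣n⇒∣m*n (γ ℤ.* y) p∣y)) (ℤ∣.∣n⇒∣m*n (β ℤ.* x) p∣y))

  form-∤-x : ∀ {α β γ x y} → + p ∣ℤ x → ¬ + p ∣ℤ γ → ¬ + p ∣ℤ y → ¬ + p ∣ℤ form α β γ x y
  form-∤-x {α} {β} {γ} {x} {y} p∣x p∤γ p∤y p∣F =
    form-∤-y {γ} {β} {α} p∣x p∤γ p∤y (subst (+ p ∣ℤ_) (form-swap α β γ x y) p∣F)

  form-∤-xy : ∀ {α β γ x y} → + p ∣ℤ α → + p ∣ℤ γ → ¬ + p ∣ℤ β → ¬ + p ∣ℤ x → ¬ + p ∣ℤ y →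
              ¬ + p ∣ℤ form α β γ x y
  form-∤-xy {α} {β} {γ} {x} {y} p∣α p∣γ p∤β p∤x p∤y p∣F = prime-∤-* (prime-∤-* p∤β p∤x) p∤y
    (ℤ∣.∣m+n∣m⇒∣n (ℤ∣.∣m+n∣n⇒∣m p∣F (ℤ∣.∣m⇒∣m*n y (ℤ∣.∣m⇒∣m*n y p∣γ)))
                  (ℤ∣.∣m⇒∣m*n x (ℤ∣.∣m⇒∣m*n x p∣α)))

module _ {P : ℕ → Set} (P? : Decidable P) where

  productWhere : ℕ → ℕ
  productWhere zero = 1
  productWhere (suc k) with P? (suc k)
  ... | yes _ = suc k ℕ.* productWhere k
  ... | no  _ = productWhere k

  productWhere-positive : ∀ N → 1 ≤ productWhere N
  productWhere-positive zero = s≤s z≤n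
  productWhere-positive (suc k) with P? (suc k)
  ... | yes _ = ℕ.*-mono-≤ {1} {suc k} (s≤s z≤n) (productWhere-positive k)
  ... | no  _ = productWhere-positive k

  ∣-productWhere : ∀ {N k} → P k → 1 ≤ k → k ≤ N → k ∣ℕ productWhere N
  ∣-productWhere {zero} _ 1≤k k≤0 = ⊥-elim (ℕ.<⇒≱ 1≤k k≤0)
  ∣-productWhere {suc N} {k} pk 1≤k k≤N with P? (suc N) | ℕ.m≤n⇒m<n∨m≡n k≤N
  ... | yes _ | inj₂ refl = ℕ∣.m∣m*n _
  ... | no ¬p | inj₂ refl = ⊥-elim (¬p pk)
  ... | yes _ | inj₁ k<N  = ℕ∣.∣n⇒∣m*n (suc N) (∣-productWhere pk 1≤k (ℕ.≤-pred k<N))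
  ... | no  _ | inj₁ k<N  = ∣-productWhere pk 1≤k (ℕ.≤-pred k<N)

  prime∣productWhere : (∀ {k} → P k → Prime k) → ∀ {N q} → Prime q → q ∣ℕ productWhere N → P q
  prime∣productWhere _ {zero} q-prime q∣1 = ⊥-elim (ℕ.<⇒≢ (prime>1 q-prime) (sym (ℕ∣.∣1⇒≡1 q∣1)))
  prime∣productWhere P⇒prime {suc N} {q} q-prime q∣∏ with P? (suc N)
  ... | no  _ = prime∣productWhere P⇒prime {N} q-prime q∣∏
  ... | yes PN with euclidsLemma (suc N) _ q-prime q∣∏
  ...   | inj₂ q∣rest = prime∣productWhere P⇒prime {N} q-prime q∣rest
  ...   | inj₁ q∣N with prime⇒irreducible (P⇒prime PN) q∣N
  ...     | inj₁ refl = ⊥-elim (ℕ.<-irrefl refl (prime>1 q-prime))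
  ...     | inj₂ refl = PN

CoprimeValue : ℤ → ℤ → ℤ → ℕ → Set
CoprimeValue α β γ N = ∃[ x ] ∃[ y ] Coprime x y × Coprime ∣ form α β γ (+ x) (+ y) ∣ N

form-coprime-value : ∀ α β γ {N} → 1 ≤ N →
                     (∀ {p} → Prime p → p ∣ℕ N → + p ∣ℤ α → + p ∣ℤ γ → ¬ + p ∣ℤ β) → CoprimeValue α β γ N
form-coprime-value α β γ {N} 1≤N locally-primitive = x , y , coprime-xy , Coprime.sym coprime-NF
  where
  instance
    N≢0 : NonZero N
    N≢0 = ℕ.>-nonZero 1≤N
  X Y : ℕ → Set
  X k = Prime k × k ∣ℕ N × k ∣ℕ ∣ α ∣ × ¬ k ∣ℕ ∣ γ ∣
  Y k = Prime k × k ∣ℕ N × ¬ k ∣ℕ ∣ α ∣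
  X? : Decidable X
  X? k = prime? k ×-dec k ∣? N ×-dec k ∣? ∣ α ∣ ×-dec ¬? (k ∣? ∣ γ ∣)
  Y? : Decidable Y
  Y? k = prime? k ×-dec k ∣? N ×-dec ¬? (k ∣? ∣ α ∣)
  x y : ℕ
  x = productWhere X? N
  y = productWhere Y? N
  x-primes : ∀ {p} → Prime p → p ∣ℕ x → p ∣ℕ ∣ α ∣ × ¬ p ∣ℕ ∣ γ ∣
  x-primes pp p∣x = proj₂ (proj₂ (prime∣productWhere X? proj₁ {N} pp p∣x))
  y-primes : ∀ {p} → Prime p → p ∣ℕ y → ¬ p ∣ℕ ∣ α ∣
  y-primes pp p∣y = proj₂ (proj₂ (prime∣productWhere Y? proj₁ {N} pp p∣y))
  ∣-x : ∀ {p} → X p → + p ∣ℤ + x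
  ∣-x Xp@(pp , p∣N , _) = ∣ᵤ⇒∣ {i = + x} (∣-productWhere X? Xp (ℕ.<⇒≤ (prime>1 pp)) (ℕ∣.∣⇒≤ p∣N))
  ∣-y : ∀ {p} → Y p → + p ∣ℤ + y
  ∣-y Yp@(pp , p∣N , _) = ∣ᵤ⇒∣ {i = + y} (∣-productWhere Y? Yp (ℕ.<⇒≤ (prime>1 pp)) (ℕ∣.∣⇒≤ p∣N))
  coprime-xy : Coprime x y
  coprime-xy = no-common-prime⇒coprime (productWhere-positive X? N) λ pp p∣x p∣y →
    y-primes pp p∣y (proj₁ (x-primes pp p∣x))
  ∤-form : ∀ {p} → Prime p → p ∣ℕ N → ¬ + p ∣ℤ form α β γ (+ x) (+ y)
  ∤-form {p} pp p∣N with p ∣? ∣ α ∣ | p ∣? ∣ γ ∣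
  ... | no p∤α | _ = form-∤-y pp {α} {β} {γ} (∣-y (pp , p∣N , p∤α))
    (λ p∣α → p∤α (∣⇒∣ᵤ {i = α} p∣α))
    (λ p∣x → p∤α (proj₁ (x-primes pp (∣⇒∣ᵤ {i = + x} p∣x))))
  ... | yes p∣α | no p∤γ = form-∤-x pp {α} {β} {γ} (∣-x (pp , p∣N , p∣α , p∤γ))
    (λ p∣γ → p∤γ (∣⇒∣ᵤ {i = γ} p∣γ))
    (λ p∣y → y-primes pp (∣⇒∣ᵤ {i = + y} p∣y) p∣α)
  ... | yes p∣α | yes p∣γ = form-∤-xy pp (∣ᵤ⇒∣ {i = α} p∣α) (∣ᵤ⇒∣ {i = γ} p∣γ)
    (locally-primitive pp p∣N (∣ᵤ⇒∣ {i = α} p∣α) (∣ᵤ⇒∣ {i = γ} p∣γ))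
    (λ p∣x → proj₂ (x-primes pp (∣⇒∣ᵤ {i = + x} p∣x)) p∣γ)
    (λ p∣y → y-primes pp (∣⇒∣ᵤ {i = + y} p∣y) p∣α)
  coprime-NF : Coprime N ∣ form α β γ (+ x) (+ y) ∣
  coprime-NF = no-common-prime⇒coprime 1≤N λ pp p∣N p∣F →
    ∤-form pp p∣N (∣ᵤ⇒∣ {i = form α β γ (+ x) (+ y)} p∣F)

abs-align : ∀ u n → ∃[ x ] ∣ x ∣ ≡ n × u ℤ.* x ≡ + (∣ u ∣ ℕ.* n)
abs-align (+ m)    n = + n , refl , sym (ℤ.pos-* m n)
abs-align -[1+ m ] n = ℤ.- + n , ℤ.∣-i∣≡∣i∣ (+ n) , trans (neg*neg (+ suc m) (+ n)) (sym (ℤ.pos-* (suc m) n))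
  where
  neg*neg : ∀ i j → ℤ.- i ℤ.* ℤ.- j ≡ i ℤ.* j
  neg*neg = solve-∀

bézout-shift : ∀ {g β ε x y} → 1 ℕ.+ y ℕ.* ε ≡ x ℕ.* β → g ℕ.* β ℕ.* x ≡ g ℕ.+ g ℕ.* ε ℕ.* y
bézout-shift {g} {β} {ε} {x} {y} eq = begin
  g ℕ.* β ℕ.* x           ≡⟨ ℕ.*-assoc g β x ⟩
  g ℕ.* (β ℕ.* x)         ≡⟨ cong (g ℕ.*_) (trans (ℕ.*-comm β x) (sym eq)) ⟩
  g ℕ.* (1 ℕ.+ y ℕ.* ε)   ≡⟨ ℕ.*-distribˡ-+ g 1 (y ℕ.* ε) ⟩
  g ℕ.* 1 ℕ.+ g ℕ.* (y ℕ.* ε) ≡⟨ cong₂ ℕ._+_ (ℕ.*-identityʳ g) (trans (cong (g ℕ.*_) (ℕ.*-comm y ε))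
                                                                      (sym (ℕ.*-assoc g ε y))) ⟩
  g ℕ.+ g ℕ.* ε ℕ.* y     ∎
  where open ≡-Reasoning

coprime-of-bézout : ∀ {x y β ε} → 1 ℕ.+ y ℕ.* ε ≡ x ℕ.* β → Coprime x y
coprime-of-bézout {x} {y} {β} {ε} eq {d} (d∣x , d∣y) =
  ℕ∣.∣1⇒≡1 (ℕ∣.∣m+n∣m⇒∣n (subst (d ∣ℕ_) yε+1≡βx (ℕ∣.∣n⇒∣m*n β d∣x)) (ℕ∣.∣m⇒∣m*n ε d∣y))
  where
  yε+1≡βx : β ℕ.* x ≡ y ℕ.* ε ℕ.+ 1
  yε+1≡βx = sym (trans (ℕ.+-comm (y ℕ.* ε) 1) (trans eq (ℕ.*-comm x β)))

bézout-divisor : ∀ u v → u ≢ 0ℤ → ∃[ x ] ∃[ y ] Coprime ∣ x ∣ ∣ y ∣ ×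
                 (u ℤ.* x ℤ.+ v ℤ.* y) ∣ℤ u × (u ℤ.* x ℤ.+ v ℤ.* y) ∣ℤ v
bézout-divisor u v u≢0 = from-identity (coprime-Bézout (coprime-/gcd U V))
  where
  U V g : ℕ
  U = ∣ u ∣
  V = ∣ v ∣
  g = gcd U V
  instance
    g≢0 : NonZero g
    g≢0 = ℕ.≢-nonZero (gcd[m,n]≢0 U V (inj₁ λ U≡0 → u≢0 (ℤ.∣i∣≡0⇒i≡0 U≡0)))
  gβ≡U : g ℕ.* (U / g) ≡ U
  gβ≡U = m*[n/m]≡n (gcd[m,n]∣m U V)
  gε≡V : g ℕ.* (V / g) ≡ V
  gε≡V = m*[n/m]≡n (gcd[m,n]∣n U V)
  Result : Set
  Result = ∃[ x ] ∃[ y ] Coprime ∣ x ∣ ∣ y ∣ × (u ℤ.* x ℤ.+ v ℤ.* y) ∣ℤ u × (u ℤ.* x ℤ.+ v ℤ.* y) ∣ℤ v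
  combine : ∀ x y → Coprime x y → ∣ + (U ℕ.* x) ℤ.- + (V ℕ.* y) ∣ ≡ g → Result
  combine x y coprime ∣S∣≡g with abs-align u x | abs-align v y
  ... | X , ∣X∣≡x , uX≡Ux | Y , ∣Y∣≡y , vY≡Vy = X , ℤ.- Y , coprime′ , S∣ (gcd[m,n]∣m U V) , S∣ (gcd[m,n]∣n U V)
    where
    coprime′ : Coprime ∣ X ∣ ∣ ℤ.- Y ∣
    coprime′ = subst₂ Coprime (sym ∣X∣≡x) (sym (trans (ℤ.∣-i∣≡∣i∣ Y) ∣Y∣≡y)) coprime
    S≡ : u ℤ.* X ℤ.+ v ℤ.* ℤ.- Y ≡ + (U ℕ.* x) ℤ.- + (V ℕ.* y)
    S≡ = cong₂ ℤ._+_ uX≡Ux (trans (sym (ℤ.neg-distribʳ-* v Y)) (cong ℤ.-_ vY≡Vy))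
    S∣ : ∀ {w} → g ∣ℕ ∣ w ∣ → (u ℤ.* X ℤ.+ v ℤ.* ℤ.- Y) ∣ℤ w
    S∣ g∣w = ∣ᵤ⇒∣ (subst (_∣ℕ _) (sym (trans (cong ∣_∣ S≡) ∣S∣≡g)) g∣w)
  i+j-j≡i : ∀ i j → i ℤ.+ j ℤ.- j ≡ i
  i+j-j≡i = solve-∀
  j-[i+j]≡-i : ∀ i j → j ℤ.- (i ℤ.+ j) ≡ ℤ.- i
  j-[i+j]≡-i = solve-∀
  from-identity : Bézout.Identity 1 (U / g) (V / g) → Result
  from-identity (Bézout.+- x y eq) = combine x y (coprime-of-bézout eq) (cong ∣_∣ (begin
    + (U ℕ.* x) ℤ.- + (V ℕ.* y)          ≡⟨ cong (λ t → + (t ℕ.* x) ℤ.- + (V ℕ.* y)) gβ≡U ⟨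
    + (g ℕ.* (U / g) ℕ.* x) ℤ.- + (V ℕ.* y) ≡⟨ cong (λ t → + t ℤ.- + (V ℕ.* y)) (bézout-shift {g} eq) ⟩
    + (g ℕ.+ g ℕ.* (V / g) ℕ.* y) ℤ.- + (V ℕ.* y) ≡⟨ cong (λ t → + (g ℕ.+ t ℕ.* y) ℤ.- + (V ℕ.* y)) gε≡V ⟩
    + (g ℕ.+ V ℕ.* y) ℤ.- + (V ℕ.* y)    ≡⟨ cong (ℤ._- + (V ℕ.* y)) (ℤ.pos-+ g (V ℕ.* y)) ⟩
    + g ℤ.+ + (V ℕ.* y) ℤ.- + (V ℕ.* y)  ≡⟨ i+j-j≡i (+ g) (+ (V ℕ.* y)) ⟩
    + g                                  ∎))
    where open ≡-Reasoning
  from-identity (Bézout.-+ x y eq) = combine x y (Coprime.sym (coprime-of-bézout eq)) (trans (cong ∣_∣ (begin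
    + (U ℕ.* x) ℤ.- + (V ℕ.* y)          ≡⟨ cong (λ t → + (U ℕ.* x) ℤ.- + (t ℕ.* y)) gε≡V ⟨
    + (U ℕ.* x) ℤ.- + (g ℕ.* (V / g) ℕ.* y) ≡⟨ cong (λ t → + (U ℕ.* x) ℤ.- + t) (bézout-shift {g} eq) ⟩
    + (U ℕ.* x) ℤ.- + (g ℕ.+ g ℕ.* (U / g) ℕ.* x) ≡⟨ cong (λ t → + (U ℕ.* x) ℤ.- + (g ℕ.+ t ℕ.* x)) gβ≡U ⟩
    + (U ℕ.* x) ℤ.- + (g ℕ.+ U ℕ.* x)    ≡⟨ cong (λ t → + (U ℕ.* x) ℤ.- t) (ℤ.pos-+ g (U ℕ.* x)) ⟩
    + (U ℕ.* x) ℤ.- (+ g ℤ.+ + (U ℕ.* x)) ≡⟨ j-[i+j]≡-i (+ g) (+ (U ℕ.* x)) ⟩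
    ℤ.- + g                              ∎)) (ℤ.∣-i∣≡∣i∣ (+ g)))
    where open ≡-Reasoning

∣-* : ∀ {i j m n} → i ∣ℤ m → j ∣ℤ n → i ℤ.* j ∣ℤ m ℤ.* n
∣-* {i} {j} {m} {n} i∣m j∣n = ℤ∣.∣-trans (ℤ∣.*-monoˡ-∣ j i∣m) (ℤ∣.*-monoʳ-∣ m j∣n)

∣0ℤ : ∀ i → i ∣ℤ 0ℤ
∣0ℤ i = ℤ∣.divides 0ℤ refl

scaled-≢0 : ∀ k {α} → α ≢ 0ℤ → + suc k ℤ.* α ≢ 0ℤ
scaled-≢0 k α≢0 kα≡0 with ℤ.i*j≡0⇒i≡0∨j≡0 (+ suc k) kα≡0
... | inj₂ α≡0 = α≢0 α≡0

RepresentsCommonDivisor : ℤ → ℤ → ℤ → Set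
RepresentsCommonDivisor α β γ =
  ∃[ x ] ∃[ y ] Coprime ∣ x ∣ ∣ y ∣ × form α β γ x y ∣ℤ α × form α β γ x y ∣ℤ β × form α β γ x y ∣ℤ γ

degenerate-form-divisor : ∀ α β γ → β ℤ.* β ≡ + 4 ℤ.* α ℤ.* γ → RepresentsCommonDivisor α β γ
degenerate-form-divisor α β γ β²≡4αγ with α ℤ.≟ 0ℤ
... | yes refl = 0ℤ , 1ℤ , Coprime.sym (1-coprimeTo 0) , ∣0ℤ _ , F∣β , ℤ∣.∣-reflexive (form-0-1 β γ)
  where
  F∣β : form 0ℤ β γ 0ℤ 1ℤ ∣ℤ β
  F∣β with ℤ.i*j≡0⇒i≡0∨j≡0 β β²≡4αγ
  ... | inj₁ refl = ∣0ℤ _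
  ... | inj₂ refl = ∣0ℤ _
... | no α≢0 with bézout-divisor (+ 2 ℤ.* α) β (scaled-≢0 1 α≢0)
...   | x , y , coprime , S∣2α , S∣β = x , y , coprime , F∣α , F∣β , F∣γ
  where
  open ≡-Reasoning
  F = form α β γ x y
  S = + 2 ℤ.* α ℤ.* x ℤ.+ β ℤ.* y
  instance
    4α≢0 : ℤ.NonZero (+ 4 ℤ.* α)
    4α≢0 = ℤ.≢-nonZero (scaled-≢0 3 α≢0)
    2α≢0 : ℤ.NonZero (+ 2 ℤ.* α)
    2α≢0 = ℤ.≢-nonZero (scaled-≢0 1 α≢0)
  4αF≡S² : + 4 ℤ.* α ℤ.* F ≡ S ℤ.* S
  4αF≡S² = begin
    + 4 ℤ.* α ℤ.* F                                         ≡⟨ form-complete-square α β γ x y ⟩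
    S ℤ.* S ℤ.+ (+ 4 ℤ.* α ℤ.* γ ℤ.- β ℤ.* β) ℤ.* y ℤ.* y  ≡⟨ cong (λ t → S ℤ.* S ℤ.+ t ℤ.* y ℤ.* y) 4αγ-β²≡0 ⟩
    S ℤ.* S ℤ.+ 0ℤ ℤ.* y ℤ.* y                              ≡⟨ ℤ.+-identityʳ (S ℤ.* S) ⟩
    S ℤ.* S                                                 ∎
    where
    4αγ-β²≡0 : + 4 ℤ.* α ℤ.* γ ℤ.- β ℤ.* β ≡ 0ℤ
    4αγ-β²≡0 = trans (cong (λ t → + 4 ℤ.* α ℤ.* γ ℤ.- t) β²≡4αγ) (ℤ.+-inverseʳ (+ 4 ℤ.* α ℤ.* γ))
  2α*2α≡4α*α : ∀ α → + 2 ℤ.* α ℤ.* (+ 2 ℤ.* α) ≡ + 4 ℤ.* α ℤ.* α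
  2α*2α≡4α*α = solve-∀
  4αF≡2α*2F : ∀ α F → + 4 ℤ.* α ℤ.* F ≡ + 2 ℤ.* α ℤ.* (+ 2 ℤ.* F)
  4αF≡2α*2F = solve-∀
  F∣α : F ∣ℤ α
  F∣α = ℤ∣.*-cancelˡ-∣ (+ 4 ℤ.* α) (subst₂ _∣ℤ_ (sym 4αF≡S²) (2α*2α≡4α*α α) (∣-* S∣2α S∣2α))
  F∣γ : F ∣ℤ γ
  F∣γ = ℤ∣.*-cancelˡ-∣ (+ 4 ℤ.* α) (subst₂ _∣ℤ_ (sym 4αF≡S²) β²≡4αγ (∣-* S∣β S∣β))
  F∣β : F ∣ℤ β
  F∣β = ℤ∣.∣-trans (ℤ∣.∣n⇒∣m*n (+ 2) ℤ∣.∣-refl)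
          (ℤ∣.*-cancelˡ-∣ (+ 2 ℤ.* α) (subst₂ _∣ℤ_ (trans (sym 4αF≡S²) (4αF≡2α*2F α F)) refl (∣-* S∣2α S∣β)))

-- Lines, and the choice of ρ

unit-of-abs : ∀ {i} → ∣ i ∣ ≡ 1 → i ≡ 1ℤ ⊎ i ≡ -1ℤ
unit-of-abs {+ .1}       refl = inj₁ refl
unit-of-abs { -[1+ .0 ]} refl = inj₂ refl

line⇒unit-curvature : ∀ {A} → Primitive A → Curv A 0ℤ → Curv A 1ℤ ⊎ Curv A -1ℤ
line⇒unit-curvature {A} prim (b , c , d , r) = from-divisor (degenerate-form-divisor α β γ β²≡4αγ)
  where
  α β γ : ℤ
  α = 0ℤ ℤ.+ b
  β = 0ℤ ℤ.+ b ℤ.+ c ℤ.- d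
  γ = 0ℤ ℤ.+ c
  β²≡4αγ : β ℤ.* β ≡ + 4 ℤ.* α ℤ.* γ
  β²≡4αγ = ℤ.i-j≡0⇒i≡j _ _ (trans (fC-discriminant 0ℤ b c d) (cong (λ t → 0ℤ ℤ.- t) (reachable-descartes r)))
  from-divisor : RepresentsCommonDivisor α β γ → Curv A 1ℤ ⊎ Curv A -1ℤ
  from-divisor (x , y , coprime , F∣α , F∣β , F∣γ) = from-tangent (fC-coprime-tangentℤ x y coprime r)
    where
    F = form α β γ x y
    ∣F∣≡1 : ∣ F ∣ ≡ 1
    ∣F∣≡1 = primitive-common-divisor prim r (fC-coefficients-∣ (∣0ℤ F) F∣α F∣β F∣γ)
    from-tangent : TangentValue A 0ℤ F → Curv A 1ℤ ⊎ Curv A -1ℤ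
    from-tangent (b′ , c′ , d′ , r′ , F≡0+b′) = Sum.map (λ F≡1 → subst (Curv A) (trans b′≡F F≡1) curv-b′)
                                                        (λ F≡-1 → subst (Curv A) (trans b′≡F F≡-1) curv-b′)
                                                        (unit-of-abs ∣F∣≡1)
      where
      curv-b′ : Curv A b′
      curv-b′ = 0ℤ , c′ , d′ , swap₁₂ r′
      b′≡F : b′ ≡ F
      b′≡F = trans (sym (ℤ.+-identityˡ b′)) (sym F≡0+b′)

RhoWitness : Packing → ℕ → ℤ → ℤ → ℤ → Set
RhoWitness A N b c d = ∃[ ρ ] IsRho (+ N) b c d ρ × ∃[ b′ ] Curv A b′ × + N ∣ℤ + ρ ℤ.- b′

rho-witness : ∀ {A N b c d} → Primitive A → 1 ≤ N → Reachable A (quad (+ N) b c d) → RhoWitness A N b c d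
rho-witness {A} {N} {b} {c} {d} prim 1≤N r = from-value (form-coprime-value α β γ 1≤N locally-primitive)
  where
  instance
    N≢0 : NonZero N
    N≢0 = ℕ.>-nonZero 1≤N
  n α β γ : ℤ
  n = + N
  α = n ℤ.+ b
  β = n ℤ.+ b ℤ.+ c ℤ.- d
  γ = n ℤ.+ c
  locally-primitive : ∀ {p} → Prime p → p ∣ℕ N → + p ∣ℤ α → + p ∣ℤ γ → ¬ + p ∣ℤ β
  locally-primitive pp p∣N p∣α p∣γ p∣β = ℕ.<-irrefl
    (sym (primitive-common-divisor prim r (fC-coefficients-∣ (∣ᵤ⇒∣ {i = n} p∣N) p∣α p∣β p∣γ))) (prime>1 pp)
  r+n-[r+qn]≡n-qn : ∀ r n q → r ℤ.+ n ℤ.- (r ℤ.+ q ℤ.* n) ≡ n ℤ.- q ℤ.* n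
  r+n-[r+qn]≡n-qn = solve-∀
  ρ-b′≡ρ-[n+b′]+n : ∀ ρ n b′ → ρ ℤ.- b′ ≡ ρ ℤ.- (n ℤ.+ b′) ℤ.+ n
  ρ-b′≡ρ-[n+b′]+n = solve-∀
  from-value : CoprimeValue α β γ N → RhoWitness A N b c d
  from-value (x , y , coprime-xy , coprime-FN) = ρ , is-rho , from-tangent (fC-coprime-tangent x y coprime-xy r)
    where
    open ≡-Reasoning
    F = fC n b c d (+ x) (+ y)
    R = F %ℕ N
    ρ = R ℕ.+ N
    coprime-ρN : Coprime ρ N
    coprime-ρN {e} (e∣ρ , e∣N) = coprime-FN (∣%ℕ⇒∣ F e∣N e∣R , e∣N)
      where
      e∣R : e ∣ℕ R
      e∣R = ℕ∣.∣m+n∣m⇒∣n (subst (e ∣ℕ_) (ℕ.+-comm R N) e∣ρ) e∣N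
    ρ-F≡n-qn : + ρ ℤ.- F ≡ n ℤ.- F /ℕ N ℤ.* n
    ρ-F≡n-qn = begin
      + (R ℕ.+ N) ℤ.- F                     ≡⟨ cong₂ ℤ._-_ (ℤ.pos-+ R N) (a≡a%ℕn+[a/ℕn]*n F N) ⟩
      + R ℤ.+ n ℤ.- (+ R ℤ.+ F /ℕ N ℤ.* n)  ≡⟨ r+n-[r+qn]≡n-qn (+ R) n (F /ℕ N) ⟩
      n ℤ.- F /ℕ N ℤ.* n                    ∎
    n∣ρ-F : n ∣ℤ + ρ ℤ.- F
    n∣ρ-F = subst (n ∣ℤ_) (sym ρ-F≡n-qn) (ℤ∣.∣m∣n⇒∣m-n ℤ∣.∣-refl (ℤ∣.∣n⇒∣m*n (F /ℕ N) ℤ∣.∣-refl))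
    n∣ρ-F·1·1 : n ∣ℤ + ρ ℤ.- F ℤ.* 1ℤ ℤ.* 1ℤ
    n∣ρ-F·1·1 = subst (λ t → n ∣ℤ + ρ ℤ.- t) (sym (trans (ℤ.*-identityʳ _) (ℤ.*-identityʳ F))) n∣ρ-F
    is-rho : IsRho n b c d ρ
    is-rho = ℕ.≤-trans 1≤N (ℕ.m≤n+m N R) , coprime-ρN , + x , + y , 1ℤ ,
             coprime-xy , coprime-FN , 1-coprimeTo N , ∣⇒∣ᵤ n∣ρ-F·1·1
    from-tangent : TangentValue A n F → ∃[ b′ ] Curv A b′ × n ∣ℤ + ρ ℤ.- b′
    from-tangent (b′ , c′ , d′ , r′ , F≡n+b′) = b′ , (n , c′ , d′ , swap₁₂ r′) ,
      subst (n ∣ℤ_) (sym (trans (ρ-b′≡ρ-[n+b′]+n (+ ρ) n b′) (cong (λ t → + ρ ℤ.- t ℤ.+ n) (sym F≡n+b′))))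
            (ℤ∣.∣m∣n⇒∣m+n n∣ρ-F ℤ∣.∣-refl)

-- The obstructions

square-mod-4 : ∀ M → (M ℕ.* M) % 4 ≤ 1
square-mod-4 M = subst (_≤ 1) (sym (%-distribˡ-* M M 4)) (residue-square (M % 4) (m%n<n M 4))
  where
  residue-square : ∀ r → r < 4 → (r ℕ.* r) % 4 ≤ 1
  residue-square 0 _ = z≤n
  residue-square 1 _ = s≤s z≤n
  residue-square 2 _ = z≤n
  residue-square 3 _ = s≤s z≤n
  residue-square (suc (suc (suc (suc _)))) (s≤s (s≤s (s≤s (s≤s ()))))

4u∣u·M² : ∀ {u M} → 2 ≤ u % 4 → (u ℕ.* (M ℕ.* M)) % 4 ≤ 1 → 4 ℕ.* u ∣ℕ u ℕ.* (M ℕ.* M)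
4u∣u·M² {u} {M} 2≤u%4 N%4≤1 with (M ℕ.* M) % 4 in M²%4 | square-mod-4 M
... | 0 | _ = subst (_∣ℕ u ℕ.* (M ℕ.* M)) (ℕ.*-comm u 4) (ℕ∣.*-monoʳ-∣ u (m%n≡0⇒n∣m _ 4 M²%4))
... | 1 | _ = ⊥-elim (ℕ.<⇒≱ 2≤u%4 (subst (_≤ 1) N%4≡u%4 N%4≤1))
  where
  open ≡-Reasoning
  N%4≡u%4 : (u ℕ.* (M ℕ.* M)) % 4 ≡ u % 4
  N%4≡u%4 = begin
    (u ℕ.* (M ℕ.* M)) % 4           ≡⟨ %-distribˡ-* u (M ℕ.* M) 4 ⟩
    ((u % 4) ℕ.* ((M ℕ.* M) % 4)) % 4 ≡⟨ cong (λ t → ((u % 4) ℕ.* t) % 4) M²%4 ⟩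
    ((u % 4) ℕ.* 1) % 4             ≡⟨ cong (_% 4) (ℕ.*-identityʳ (u % 4)) ⟩
    u % 4 % 4                       ≡⟨ m%n%n≡m%n u 4 ⟩
    u % 4                           ∎
... | suc (suc _) | s≤s ()

∣-sub-%ℕ24 : ∀ {D N ρ b′} → D ∣ℕ N → D ∣ℕ 24 → + N ∣ℤ + ρ ℤ.- b′ → + D ∣ℤ + ρ ℤ.- + (b′ %ℕ 24)
∣-sub-%ℕ24 {D} {N} {ρ} {b′} D∣N D∣24 N∣ρ-b′ = subst (+ D ∣ℤ_) (sym split)
  (ℤ∣.∣m∣n⇒∣m+n (ℤ∣.∣-trans (∣ᵤ⇒∣ {i = + N} D∣N) N∣ρ-b′)
                (ℤ∣.∣n⇒∣m*n (b′ /ℕ 24) (∣ᵤ⇒∣ {i = + 24} D∣24)))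
  where
  identity : ∀ ρ b′ r q → ρ ℤ.- r ≡ ρ ℤ.- (r ℤ.+ q) ℤ.+ q
  identity = solve-∀
  split : + ρ ℤ.- + (b′ %ℕ 24) ≡ + ρ ℤ.- b′ ℤ.+ (b′ /ℕ 24) ℤ.* + 24
  split = trans (identity (+ ρ) b′ (+ (b′ %ℕ 24)) ((b′ /ℕ 24) ℤ.* + 24))
                (cong (λ t → + ρ ℤ.- t ℤ.+ (b′ /ℕ 24) ℤ.* + 24) (sym (a≡a%ℕn+[a/ℕn]*n b′ 24)))

-- exactly u ∈ {1, 2, 3, 6}
AdmissibleMultiplier : ℕ → Set
AdmissibleMultiplier u = u ≡ 1 ⊎ (2 ≤ u % 4 × 4 ℕ.* u ∣ℕ 24)

admissible-positive : ∀ {u} → AdmissibleMultiplier u → 1 ≤ u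
admissible-positive (inj₁ refl) = s≤s z≤n
admissible-positive {u} (inj₂ (2≤u%4 , _)) = ℕ.≤-trans (ℕ.<⇒≤ 2≤u%4) (m%n≤m u 4)

kronecker⁺-%ℕ24 : ∀ {u M ρ b′} → AdmissibleMultiplier u → (u ℕ.* (M ℕ.* M)) % 4 ≤ 1 →
                  + (u ℕ.* (M ℕ.* M)) ∣ℤ + ρ ℤ.- b′ → kronecker⁺ (+ ρ) u ≡ kronecker⁺ (+ (b′ %ℕ 24)) u
kronecker⁺-%ℕ24 (inj₁ refl) _ _ = refl
kronecker⁺-%ℕ24 {u} {M} {ρ} {b′} (inj₂ (2≤u%4 , 4u∣24)) N%4≤1 N∣ρ-b′ =
  kronecker⁺-periodic u (∣-sub-%ℕ24 {N = u ℕ.* (M ℕ.* M)} {ρ} {b′} (4u∣u·M² {u} {M} 2≤u%4 N%4≤1) 4u∣24 N∣ρ-b′)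

curvature-residue : ∀ {A L} → HasResidues A L → ∀ {c} → Curv A c → c %ℕ 24 ∈ L
curvature-residue residues {c} curv = Equivalence.to (residues (c %ℕ 24)) (c , curv , refl)

module _ {A : Packing} {L : List ℕ} {ε : ℤ} (prim : Primitive A) (residues : HasResidues A L)
         (χ₂ : Chi2 A ε) (squares-mod-4 : All (λ r → r % 4 ≤ 1) L) where

  curvature-mod-4 : ∀ {N} → Curv A (+ N) → N % 4 ≤ 1
  curvature-mod-4 {N} curv = subst (_≤ 1) (m∣n⇒o%n%m≡o%m 4 24 N (divides 6 refl))
                                    (All.lookup squares-mod-4 (curvature-residue residues curv))

  u·M²-curvature⇒character : ∀ {u M} → AdmissibleMultiplier u → 1 ≤ M → Curv A (+ (u ℕ.* (M ℕ.* M))) →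
                             ∃[ r ] r ∈ L × kronecker⁺ (+ r) u ≡ ε
  u·M²-curvature⇒character {u} {M} admissible 1≤M curv@(b , c , d , r) = from-rho (rho-witness prim 1≤N r)
    where
    N = u ℕ.* (M ℕ.* M)
    1≤u : 1 ≤ u
    1≤u = admissible-positive admissible
    1≤N : 1 ≤ N
    1≤N = ℕ.*-mono-≤ 1≤u (ℕ.*-mono-≤ 1≤M 1≤M)
    N%4≤1 : N % 4 ≤ 1
    N%4≤1 = curvature-mod-4 curv
    N≢0 : + N ≢ 0ℤ
    N≢0 N≡0 = ℕ.<⇒≢ 1≤N (sym (ℤ.+-injective N≡0))
    from-rho : RhoWitness A N b c d → ∃[ r ] r ∈ L × kronecker⁺ (+ r) u ≡ ε
    from-rho (ρ , is-rho , b′ , curv′ , N∣ρ-b′) = b′ %ℕ 24 , curvature-residue residues curv′ , (begin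
      kronecker⁺ (+ (b′ %ℕ 24)) u  ≡⟨ kronecker⁺-%ℕ24 {M = M} {b′ = b′} admissible N%4≤1 N∣ρ-b′ ⟨
      kronecker⁺ (+ ρ) u           ≡⟨ kronecker⁺-*-square (+ ρ) u M 1≤u 1≤M coprime-ρM ⟨
      kronecker⁺ (+ ρ) N           ≡⟨ chiSymbol≡kronecker⁺ N ρ 1≤N N%4≤1 ⟨
      chiSymbol (+ N) ρ            ≡⟨ χ₂ (+ N) b c d r N≢0 ρ is-rho ⟩
      ε                            ∎)
      where
      open ≡-Reasoning
      coprime-ρM : Coprime ρ M
      coprime-ρM (i∣ρ , i∣M) = proj₁ (proj₂ is-rho) (i∣ρ , ∣-trans i∣M (ℕ∣.∣n⇒∣m*n u (ℕ∣.m∣m*n M)))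

  u·M²-not-curvature : ∀ {u} → AdmissibleMultiplier u → All (λ r → kronecker⁺ (+ r) u ≢ ε) L →
                       ∀ M → 1 ≤ M → ¬ Curv A (+ (u ℕ.* (M ℕ.* M)))
  u·M²-not-curvature admissible avoids M 1≤M curv =
    let _ , r∈L , χ≡ε = u·M²-curvature⇒character admissible 1≤M curv in All.lookup avoids r∈L χ≡ε

  0-not-curvature : 23 ∉ L → (1 ∈ L → ε ≢ 1ℤ) → ¬ Curv A 0ℤ
  0-not-curvature 23∉L 1∈L⇒ε≢1 = Sum.[ ¬curv-1 , ¬curv-[-1] ]′ ∘ line⇒unit-curvature prim
    where
    ¬curv-1 : ¬ Curv A 1ℤ
    ¬curv-1 curv = let _ , _ , 1≡ε = u·M²-curvature⇒character {M = 1} (inj₁ refl) (s≤s z≤n) curv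
                   in 1∈L⇒ε≢1 (curvature-residue residues curv) (sym 1≡ε)
    ¬curv-[-1] : ¬ Curv A -1ℤ
    ¬curv-[-1] curv = 23∉L (curvature-residue residues curv)

square≡∣∣² : ∀ k → k ^ 2 ≡ + (∣ k ∣ ℕ.* ∣ k ∣)
square≡∣∣² (+ n)    = trans (cong (+ n ℤ.*_) (ℤ.*-identityʳ (+ n))) (sym (ℤ.pos-* n n))
square≡∣∣² -[1+ n ] = cong (-[1+ n ] ℤ.*_) (ℤ.*-identityʳ -[1+ n ])

obstruction : ∀ {A} u → 1 ≤ u → InR A 0 → ¬ Curv A 0ℤ → (∀ M → 1 ≤ M → ¬ Curv A (+ (u ℕ.* (M ℕ.* M)))) →
              Obstruction A 2 u
obstruction {A} u 1≤u zero∈R ¬curv-0 ¬curv-u·M² = unbounded , excluded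
  where
  instance
    u≢0 : NonZero u
    u≢0 = ℕ.>-nonZero 1≤u
  u·k²≡ : ∀ k → + u ℤ.* k ^ 2 ≡ + (u ℕ.* (∣ k ∣ ℕ.* ∣ k ∣))
  u·k²≡ k = trans (cong (+ u ℤ.*_) (square≡∣∣² k)) (sym (ℤ.pos-* u _))
  multiple-of-24 : ∀ {N} K → N < K → 24 ∣ℕ K → ∃[ m ] InS 2 u m × N < abs m × InR A (m %ℕ 24)
  multiple-of-24 {N} K N<K 24∣K =
    + u ℤ.* (+ K) ^ 2 , (+ K , refl) , N<m , subst (InR A) (sym m%24≡0) zero∈R
    where
    instance
      K≢0 : NonZero K
      K≢0 = ℕ.>-nonZero (ℕ.≤-trans (s≤s z≤n) N<K)
    N<m : N < abs (+ u ℤ.* (+ K) ^ 2)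
    N<m = subst (λ t → N < abs t) (sym (u·k²≡ (+ K)))
                (ℕ.<-≤-trans N<K (ℕ.≤-trans (ℕ.m≤m*n K K) (ℕ.m≤n*m (K ℕ.* K) u)))
    m%24≡0 : (+ u ℤ.* (+ K) ^ 2) %ℕ 24 ≡ 0
    m%24≡0 = trans (cong (_%ℕ 24) (u·k²≡ (+ K))) (n∣m⇒m%n≡0 _ 24 (ℕ∣.∣n⇒∣m*n u (ℕ∣.∣m⇒∣m*n K 24∣K)))
  unbounded : ∀ N → ∃[ m ] InS 2 u m × N < abs m × InR A (m %ℕ 24)
  unbounded N = multiple-of-24 (24 ℕ.* suc N) (ℕ.m≤n*m (suc N) 24) (ℕ∣.m∣m*n (suc N))
  excluded : ∀ m → InS 2 u m → ¬ Curv A m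
  excluded m (k , m≡uk²) curv = excluded-square ∣ k ∣ (subst (Curv A) (trans m≡uk² (u·k²≡ k)) curv)
    where
    excluded-square : ∀ j → ¬ Curv A (+ (u ℕ.* (j ℕ.* j)))
    excluded-square zero    = ¬curv-0 ∘ subst (Curv A) (cong +_ (ℕ.*-zeroʳ u))
    excluded-square (suc j) = ¬curv-u·M² (suc j) (s≤s z≤n)

-- 23 ∉ L and (1 ∈ L → ε ≢ 1) exclude the curvatures -1 and 1 that a line would force.
ObstructionCriterion : List ℕ → ℤ → ℕ → Set
ObstructionCriterion L ε u = All (λ r → r % 4 ≤ 1) L × 0 ∈ L × 23 ∉ L × (1 ∈ L → ε ≢ 1ℤ) ×
                             AdmissibleMultiplier u × All (λ r → kronecker⁺ (+ r) u ≢ ε) L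

obstructionCriterion? : ∀ L ε u → Dec (ObstructionCriterion L ε u)
obstructionCriterion? L ε u =
  all? (λ r → r % 4 ≤? 1) L ×-dec 0 ∈? L ×-dec ¬? (23 ∈? L) ×-dec (1 ∈? L →-dec ¬? (ε ℤ.≟ 1ℤ)) ×-dec
  (u ℕ.≟ 1 ⊎-dec (2 ≤? u % 4 ×-dec 4 ℕ.* u ∣? 24)) ×-dec all? (λ r → ¬? (kronecker⁺ (+ r) u ℤ.≟ ε)) L

obstructionCriterion⇒obstruction : ∀ {A L ε u} → Primitive A → HasResidues A L → Chi2 A ε →
                                   ObstructionCriterion L ε u → Obstruction A 2 u
obstructionCriterion⇒obstruction {u = u} prim residues χ₂
  (squares-mod-4 , 0∈L , 23∉L , 1∈L⇒ε≢1 , admissible , avoids) =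
  obstruction u (admissible-positive admissible) (Equivalence.from (residues 0) 0∈L)
    (0-not-curvature prim residues χ₂ squares-mod-4 23∉L 1∈L⇒ε≢1)
    (u·M²-not-curvature prim residues χ₂ squares-mod-4 admissible avoids)

proposition4p10 : (A : Packing) → Primitive A →
    ((HasResidues A R61 → Chi2 A -1ℤ →
        Obstruction A 2 1 × Obstruction A 2 2 × Obstruction A 2 3 × Obstruction A 2 6) ×
     (HasResidues A R65 → Chi2 A 1ℤ →
        Obstruction A 2 2 × Obstruction A 2 3) ×
     (HasResidues A R65 → Chi2 A -1ℤ →
        Obstruction A 2 1 × Obstruction A 2 6) ×
     (HasResidues A R613 → Chi2 A 1ℤ →
        Obstruction A 2 2 × Obstruction A 2 6) ×
     (HasResidues A R613 → Chi2 A -1ℤ →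
        Obstruction A 2 1 × Obstruction A 2 3) ×
     (HasResidues A R617 → Chi2 A 1ℤ →
        Obstruction A 2 3 × Obstruction A 2 6) ×
     (HasResidues A R617 → Chi2 A -1ℤ →
        Obstruction A 2 1 × Obstruction A 2 2))
proposition4p10 A prim =
  (λ R χ → S₂ R χ 1 , S₂ R χ 2 , S₂ R χ 3 , S₂ R χ 6) ,
  (λ R χ → S₂ R χ 2 , S₂ R χ 3) ,
  (λ R χ → S₂ R χ 1 , S₂ R χ 6) ,
  (λ R χ → S₂ R χ 2 , S₂ R χ 6) ,
  (λ R χ → S₂ R χ 1 , S₂ R χ 3) ,
  (λ R χ → S₂ R χ 3 , S₂ R χ 6) ,
  (λ R χ → S₂ R χ 1 , S₂ R χ 2)
  where
  S₂ : ∀ {L ε} → HasResidues A L → Chi2 A ε → ∀ u → {_ : True (obstructionCriterion? L ε u)} → Obstruction A 2 u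
  S₂ R χ u {criterion} = obstructionCriterion⇒obstruction prim R χ (toWitness criterion)
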